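{- Consider the Kleene number realisability interpretation of Heyting arithmetic extended by unary predicates $\mathcal V,\mathcal M,\mathcal T$, where the new atomic formulas are realised trivially: $(e\Vdash\mathcal V(x))\iff\mathcal V(x)$, $(e\Vdash\mathcal M(x))\iff\mathcal M(x)$, $(e\Vdash\mathcal T(x))\iff\mathcal T(x)$. If the axioms (V1), (V2) (all instances), (X1), (X2) hold in the underlying meta-theory, then in this realisability interpretation (V1), all instances of (V2), (X1), (X2), and all instances of $\mathsf{ECT}_V$ are realised.
   Context: $\langle\cdot,\cdot\rangle$ is Cantor pairing with projections $(\cdot)_L,(\cdot)_R$; $en$ denotes Kleene application of the $e$-th partial recursive function to $n$ and $en\!\downarrow$ that it is defined. Write $\mathrm{cd}_x(n)=(xn)_R$, $\mathrm{el}_x(n)=(xn)_L$. $\Xi(f,g)$ is a fixed primitive recursive injective coding of pairs (the paper uses odd numbers). Axioms: (V1) $\forall x\,[\forall n\,(xn\!\downarrow\wedge\mathcal M(\mathrm{cd}_x(n))\wedge(\mathcal T(\mathrm{cd}_x(n))\to\mathcal V(\mathrm{el}_x(n))))]\to\mathcal V(x)$. (V2) for every formula $\phi$: $\big(\forall x\,[\forall n\,(xn\!\downarrow\wedge\mathcal M(\mathrm{cd}_x(n))\wedge(\mathcal T(\mathrm{cd}_x(n))\to\phi(\mathrm{el}_x(n))))]\to\phi(x)\big)\to\forall x(\mathcal V(x)\to\phi(x))$. (X1) $\forall f,g\,[\mathcal M(\Xi(f,g))\to(\mathcal T(\Xi(f,g))\leftrightarrow\forall n(fn\!\downarrow\wedge\mathcal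 T(fn)\to gn\!\downarrow\wedge\mathcal T(gn)))]$. (X2) $\forall f,g\,[(\forall n(fn\!\downarrow\to\mathcal M(fn)))\wedge(\forall n(fn\!\downarrow\wedge gn\!\downarrow\wedge\mathcal T(fn)\to\mathcal M(gn)))\to\mathcal M(\Xi(f,g))]$. $\mathsf{ECT}_V$ is the schema $(\forall n(\phi(n)\to\exists m\,\psi(n,m)))\to\exists e\,\forall n(\phi(n)\to en\!\downarrow\wedge\psi(n,en))$ for $\psi$ arbitrary and $\phi$ almost-negative, where almost-negative formulas are built from $\Sigma_1$ formulas of arithmetic and atomic formulas $\mathcal V(t),\mathcal M(t),\mathcal T(t)$ using $\wedge$, $\to$ and $\forall$ over $\mathbb N$. -}

module Defs where

open import Data.Nat using (ℕ; zero; suc; _+_; _*_; _<_)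
open import Data.Fin using (Fin; zero; suc; #_)
open import Data.Product using (Σ; _×_; _,_; proj₁; proj₂)
open import Data.Sum using (_⊎_)
open import Data.Empty using (⊥)
open import Relation.Nullary using (¬_)
open import Relation.Binary.PropositionalEquality using (_≡_)

-- Cantor pairing  ⟨a,b⟩ = (a+b)(a+b+1)/2 + b  and its projections.

tri : ℕ → ℕ
tri zero    = 0
tri (suc s) = tri s + suc s

pair : ℕ → ℕ → ℕ
pair a b = tri (a + b) + b

-- inverse of pair, by walking along the diagonals
unpair : ℕ → ℕ × ℕ
unpair zero = 0 , 0
unpair (suc n) with unpair n
... | zero  , b = suc b , 0
... | suc a , b = a , suc b

pL : ℕ → ℕ
pL n = proj₁ (unpair n)

pR : ℕ → ℕ
pR n = proj₂ (unpair n)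

Xi : ℕ → ℕ → ℕ
Xi f g = suc (2 * pair f g)

-- Kleene application  e · n ≃ m  ("the e-th partial recursive function
-- applied to n is defined with value m").
-- Indexing: e = ⟨tag, a⟩ codes a unary partial recursive function built from
-- the standard basis below (Turing complete: zero, successor, identity,
-- pairing projections, composition, pairing, primitive recursion on the
-- right component, minimisation). Codes with tag ≥ 9 are nowhere defined.

infix 4 _·_≃_
data _·_≃_ : ℕ → ℕ → ℕ → Set where
  ap-zero  : ∀ {e n} → pL e ≡ 0 → e · n ≃ 0
  ap-succ  : ∀ {e n} → pL e ≡ 1 → e · n ≃ suc n
  ap-id    : ∀ {e n} → pL e ≡ 2 → e · n ≃ n
  ap-left  : ∀ {e n} → pL e ≡ 3 → e · n ≃ pL n
  ap-right : ∀ {e n} → pL e ≡ 4 → e · n ≃ pR n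
  -- composition: (f ∘ g) n, with ⟨f,g⟩ = pR e
  ap-comp  : ∀ {e n m k} → pL e ≡ 5 →
             pR (pR e) · n ≃ m → pL (pR e) · m ≃ k → e · n ≃ k
  ap-pair  : ∀ {e n a b} → pL e ≡ 6 →
             pL (pR e) · n ≃ a → pR (pR e) · n ≃ b → e · n ≃ pair a b
  -- primitive recursion: h⟨x,0⟩ = f x ; h⟨x,y+1⟩ = g⟨⟨x,y⟩, h⟨x,y⟩⟩
  ap-rec0  : ∀ {e n k} → pL e ≡ 7 → pR n ≡ 0 →
             pL (pR e) · pL n ≃ k → e · n ≃ k
  ap-recS  : ∀ {e n y r k} → pL e ≡ 7 → pR n ≡ suc y →
             e · pair (pL n) y ≃ r →
             pR (pR e) · pair (pair (pL n) y) r ≃ k → e · n ≃ k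
  -- minimisation: n ↦ least y with f⟨n,y⟩ = 0 (all earlier values defined, ≠ 0)
  ap-min   : ∀ {e n y} → pL e ≡ 8 →
             pR e · pair n y ≃ 0 →
             (∀ z → z < y → Σ ℕ (λ w → pR e · pair n z ≃ suc w)) →
             e · n ≃ y

-- Meta-level axioms (V1), (V2), (X1), (X2) for predicates V, M, T : ℕ → Set.
-- "xn↓ ∧ M(cd_x(n)) ∧ (T(cd_x(n)) → P(el_x(n)))" is rendered as
-- ∃u (x·n ≃ u ∧ M(u_R) ∧ (T(u_R) → P(u_L))).

Body : (M T : ℕ → Set) → (P : ℕ → Set) → ℕ → Set
Body M T P x = ∀ n → Σ ℕ (λ u → (x · n ≃ u) × M (pR u) × (T (pR u) → P (pL u)))

V1-meta : (V M T : ℕ → Set) → Set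
V1-meta V M T = ∀ x → Body M T V x → V x

V2-meta : (V M T : ℕ → Set) → Set₁
V2-meta V M T = (P : ℕ → Set) → (∀ x → Body M T P x → P x) → ∀ x → V x → P x

X1-meta : (M T : ℕ → Set) → Set
X1-meta M T = ∀ f g → M (Xi f g) →
  ((T (Xi f g) → Cond f g) × (Cond f g → T (Xi f g)))
  where
  Cond : ℕ → ℕ → Set
  Cond f g = ∀ n → Σ ℕ (λ u → (f · n ≃ u) × T u) → Σ ℕ (λ v → (g · n ≃ v) × T v)

X2-meta : (M T : ℕ → Set) → Set
X2-meta M T = ∀ f g →
  (∀ n u → f · n ≃ u → M u) →
  (∀ n u v → f · n ≃ u → g · n ≃ v → T u → M v) →
  M (Xi f g)

-- Object language: HA (0, S, +, ·, Cantor pairing and projections, Ξ)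
-- with the Σ1 graph of Kleene application and the predicates V, M, T.
-- de Bruijn variables: Tm n / Fm n have n free variables.

data Tm (n : ℕ) : Set where
  var  : Fin n → Tm n
  zer  : Tm n
  sucT : Tm n → Tm n
  _+T_ : Tm n → Tm n → Tm n
  _*T_ : Tm n → Tm n → Tm n
  pairT : Tm n → Tm n → Tm n
  lft  : Tm n → Tm n
  rgt  : Tm n → Tm n
  xiT  : Tm n → Tm n → Tm n

infixr 6 _∧f_
infixr 5 _∨f_
infixr 4 _⇒_

data Fm (n : ℕ) : Set where
  _≐_  : Tm n → Tm n → Fm n
  app  : Tm n → Tm n → Tm n → Fm n      -- app t s u  :  t s ≃ u
  Vf   : Tm n → Fm n
  Mf   : Tm n → Fm n
  Tf   : Tm n → Fm n
  ⊥f   : Fm n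
  _∧f_ : Fm n → Fm n → Fm n
  _∨f_ : Fm n → Fm n → Fm n
  _⇒_  : Fm n → Fm n → Fm n
  ∀f   : Fm (suc n) → Fm n
  ∃f   : Fm (suc n) → Fm n

_⇔f_ : ∀ {n} → Fm n → Fm n → Fm n
A ⇔f B = (A ⇒ B) ∧f (B ⇒ A)

extR : ∀ {n m} → (Fin n → Fin m) → Fin (suc n) → Fin (suc m)
extR r zero    = zero
extR r (suc i) = suc (r i)

renT : ∀ {n m} → (Fin n → Fin m) → Tm n → Tm m
renT r (var i)     = var (r i)
renT r zer         = zer
renT r (sucT t)    = sucT (renT r t)
renT r (t +T s)    = renT r t +T renT r s
renT r (t *T s)    = renT r t *T renT r s
renT r (pairT t s) = pairT (renT r t) (renT r s)
renT r (lft t)     = lft (renT r t)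
renT r (rgt t)     = rgt (renT r t)
renT r (xiT t s)   = xiT (renT r t) (renT r s)

renF : ∀ {n m} → (Fin n → Fin m) → Fm n → Fm m
renF r (t ≐ s)     = renT r t ≐ renT r s
renF r (app t s u) = app (renT r t) (renT r s) (renT r u)
renF r (Vf t)      = Vf (renT r t)
renF r (Mf t)      = Mf (renT r t)
renF r (Tf t)      = Tf (renT r t)
renF r ⊥f          = ⊥f
renF r (A ∧f B)    = renF r A ∧f renF r B
renF r (A ∨f B)    = renF r A ∨f renF r B
renF r (A ⇒ B)     = renF r A ⇒ renF r B
renF r (∀f A)      = ∀f (renF (extR r) A)
renF r (∃f A)      = ∃f (renF (extR r) A)

wkT : ∀ {n} → Tm n → Tm (suc n)
wkT = renT suc

extS : ∀ {n m} → (Fin n → Tm m) → Fin (suc n) → Tm (suc m)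
extS σ zero    = var zero
extS σ (suc i) = wkT (σ i)

subT : ∀ {n m} → (Fin n → Tm m) → Tm n → Tm m
subT σ (var i)     = σ i
subT σ zer         = zer
subT σ (sucT t)    = sucT (subT σ t)
subT σ (t +T s)    = subT σ t +T subT σ s
subT σ (t *T s)    = subT σ t *T subT σ s
subT σ (pairT t s) = pairT (subT σ t) (subT σ s)
subT σ (lft t)     = lft (subT σ t)
subT σ (rgt t)     = rgt (subT σ t)
subT σ (xiT t s)   = xiT (subT σ t) (subT σ s)

subF : ∀ {n m} → (Fin n → Tm m) → Fm n → Fm m
subF σ (t ≐ s)     = subT σ t ≐ subT σ s
subF σ (app t s u) = app (subT σ t) (subT σ s) (subT σ u)
subF σ (Vf t)      = Vf (subT σ t)
subF σ (Mf t)      = Mf (subT σ t)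
subF σ (Tf t)      = Tf (subT σ t)
subF σ ⊥f          = ⊥f
subF σ (A ∧f B)    = subF σ A ∧f subF σ B
subF σ (A ∨f B)    = subF σ A ∨f subF σ B
subF σ (A ⇒ B)     = subF σ A ⇒ subF σ B
subF σ (∀f A)      = ∀f (subF (extS σ) A)
subF σ (∃f A)      = ∃f (subF (extS σ) A)

closeAll : ∀ {n} → Fm n → Fm 0
closeAll {zero}  A = A
closeAll {suc n} A = closeAll (∀f A)

-- bounded quantifiers: x < t  :=  ∃k (x + S k = t)
ltF : ∀ {n} → Tm n → Tm n → Fm n
ltF a b = ∃f ((wkT a +T sucT (var zero)) ≐ wkT b)

data IsΔ0 {n : ℕ} : Fm n → Set where
  d-eq  : ∀ t s → IsΔ0 (t ≐ s)
  d-bot : IsΔ0 ⊥f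
  d-and : ∀ {A B} → IsΔ0 A → IsΔ0 B → IsΔ0 (A ∧f B)
  d-or  : ∀ {A B} → IsΔ0 A → IsΔ0 B → IsΔ0 (A ∨f B)
  d-imp : ∀ {A B} → IsΔ0 A → IsΔ0 B → IsΔ0 (A ⇒ B)
  d-ball : ∀ t {A} → IsΔ0 A → IsΔ0 (∀f (ltF (var zero) (wkT t) ⇒ A))
  d-bex  : ∀ t {A} → IsΔ0 A → IsΔ0 (∃f (ltF (var zero) (wkT t) ∧f A))

data IsΣ1 {n : ℕ} : Fm n → Set where
  s-d0  : ∀ {A} → IsΔ0 A → IsΣ1 A
  s-app : ∀ t s u → IsΣ1 (app t s u)
  s-and : ∀ {A B} → IsΣ1 A → IsΣ1 B → IsΣ1 (A ∧f B)
  s-or  : ∀ {A B} → IsΣ1 A → IsΣ1 B → IsΣ1 (A ∨f B)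
  s-ex  : ∀ {A} → IsΣ1 A → IsΣ1 (∃f A)

data IsAN {n : ℕ} : Fm n → Set where
  an-s1  : ∀ {A} → IsΣ1 A → IsAN A
  an-V   : ∀ t → IsAN (Vf t)
  an-M   : ∀ t → IsAN (Mf t)
  an-T   : ∀ t → IsAN (Tf t)
  an-and : ∀ {A B} → IsAN A → IsAN B → IsAN (A ∧f B)
  an-imp : ∀ {A B} → IsAN A → IsAN B → IsAN (A ⇒ B)
  an-all : ∀ {A} → IsAN A → IsAN (∀f A)

Env : ℕ → Set
Env n = Fin n → ℕ

_∷ρ_ : ∀ {n} → ℕ → Env n → Env (suc n)
(k ∷ρ ρ) zero    = k
(k ∷ρ ρ) (suc i) = ρ i

ρ₀ : Env 0
ρ₀ ()

⟦_⟧ : ∀ {n} → Tm n → Env n → ℕ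
⟦ var i ⟧ ρ     = ρ i
⟦ zer ⟧ ρ       = 0
⟦ sucT t ⟧ ρ    = suc (⟦ t ⟧ ρ)
⟦ t +T s ⟧ ρ    = ⟦ t ⟧ ρ + ⟦ s ⟧ ρ
⟦ t *T s ⟧ ρ    = ⟦ t ⟧ ρ * ⟦ s ⟧ ρ
⟦ pairT t s ⟧ ρ = pair (⟦ t ⟧ ρ) (⟦ s ⟧ ρ)
⟦ lft t ⟧ ρ     = pL (⟦ t ⟧ ρ)
⟦ rgt t ⟧ ρ     = pR (⟦ t ⟧ ρ)
⟦ xiT t s ⟧ ρ   = Xi (⟦ t ⟧ ρ) (⟦ s ⟧ ρ)

module Realise (V M T : ℕ → Set) where

  _⊩_[_] : ∀ {n} → ℕ → Fm n → Env n → Set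
  e ⊩ (t ≐ s) [ ρ ]     = ⟦ t ⟧ ρ ≡ ⟦ s ⟧ ρ
  e ⊩ app t s u [ ρ ]   = ⟦ t ⟧ ρ · ⟦ s ⟧ ρ ≃ ⟦ u ⟧ ρ
  e ⊩ Vf t [ ρ ]        = V (⟦ t ⟧ ρ)
  e ⊩ Mf t [ ρ ]        = M (⟦ t ⟧ ρ)
  e ⊩ Tf t [ ρ ]        = T (⟦ t ⟧ ρ)
  e ⊩ ⊥f [ ρ ]          = ⊥
  e ⊩ (A ∧f B) [ ρ ]    = (pL e ⊩ A [ ρ ]) × (pR e ⊩ B [ ρ ])
  e ⊩ (A ∨f B) [ ρ ]    = ((pL e ≡ 0) × (pR e ⊩ A [ ρ ]))
                          ⊎ ((¬ pL e ≡ 0) × (pR e ⊩ B [ ρ ]))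
  e ⊩ (A ⇒ B) [ ρ ]     = ∀ a → a ⊩ A [ ρ ] →
                          Σ ℕ (λ b → (e · a ≃ b) × (b ⊩ B [ ρ ]))
  e ⊩ ∀f A [ ρ ]        = ∀ k → Σ ℕ (λ b → (e · k ≃ b) × (b ⊩ A [ k ∷ρ ρ ]))
  e ⊩ ∃f A [ ρ ]        = pR e ⊩ A [ pL e ∷ρ ρ ]

  Realised : ∀ {n} → Fm n → Set
  Realised A = Σ ℕ (λ e → e ⊩ closeAll A [ ρ₀ ])

V1f : Fm 0
V1f = ∀f ((∀f (∃f (app (var (# 2)) (var (# 1)) (var (# 0))
                    ∧f Mf (rgt (var (# 0)))
                    ∧f (Tf (rgt (var (# 0))) ⇒ Vf (lft (var (# 0)))))))
          ⇒ Vf (var (# 0)))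

-- (V2) instance for φ(x, params), x = variable 0
V2f : ∀ {k} → Fm (suc k) → Fm k
V2f {k} φ =
  (∀f ((∀f (∃f (app (var (# 2)) (var (# 1)) (var (# 0))
                ∧f Mf (rgt (var (# 0)))
                ∧f (Tf (rgt (var (# 0))) ⇒ subF σ φ))))
       ⇒ φ))
  ⇒ ∀f (Vf (var zero) ⇒ φ)
  where
  -- φ(el_x(n)) inside context (u, n, x, params)
  σ : Fin (suc k) → Tm (suc (suc (suc k)))
  σ zero    = lft (var zero)
  σ (suc i) = var (suc (suc (suc i)))

X1f : Fm 0
X1f = ∀f (∀f (Mf (xiT (var (# 1)) (var (# 0))) ⇒
        (Tf (xiT (var (# 1)) (var (# 0))) ⇔f
          ∀f (∃f (app (var (# 3)) (var (# 1)) (var (# 0)) ∧f Tf (var (# 0)))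
              ⇒ ∃f (app (var (# 2)) (var (# 1)) (var (# 0)) ∧f Tf (var (# 0)))))))

X2f : Fm 0
X2f = ∀f (∀f ((∀f (∀f (app (var (# 3)) (var (# 1)) (var (# 0)) ⇒ Mf (var (# 0))))
               ∧f ∀f (∀f (∀f ((app (var (# 4)) (var (# 2)) (var (# 1))
                               ∧f app (var (# 3)) (var (# 2)) (var (# 0))
                               ∧f Tf (var (# 1)))
                              ⇒ Mf (var (# 0))))))
              ⇒ Mf (xiT (var (# 1)) (var (# 0)))))

-- (ECT_V) instance: φ(n, params) with n = variable 0;
-- ψ(n, m, params) with m = variable 0, n = variable 1.
-- (∀n(φ(n) → ∃m ψ(n,m))) → ∃e ∀n(φ(n) → ∃m (e n ≃ m ∧ ψ(n,m)))
ECTf : ∀ {k} → Fm (suc k) → Fm (suc (suc k)) → Fm k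
ECTf {k} φ ψ =
  ∀f (φ ⇒ ∃f ψ) ⇒
  ∃f (∀f (renF r₁ φ ⇒ ∃f (app (var (# 2)) (var (# 1)) (var (# 0)) ∧f renF r₂ ψ)))
  where
  -- context (n, e, params)
  r₁ : Fin (suc k) → Fin (suc (suc k))
  r₁ zero    = zero
  r₁ (suc i) = suc (suc i)
  -- context (m, n, e, params)
  r₂ : Fin (suc (suc k)) → Fin (suc (suc (suc k)))
  r₂ zero          = zero
  r₂ (suc zero)    = suc zero
  r₂ (suc (suc i)) = suc (suc (suc i))

-- Realisers are genuine indices for the basis of partial recursive functions behind _·_≃_. Expressions
-- compile to indices by primitive recursion, and a universal function searches for a certificate
-- (a coded derivation) of f · a ≃ v; this allows applying computed indices and forming closures,
-- which is all the λ-calculus the realisers need.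
-- (V1) and (X2) are realised trivially, since the atoms V, M, T carry no computational content, and
-- (X1) only needs to compute g n from n. For (V2), a realiser h of the premise yields, by
-- self-application, an index x ↦ g x where g x runs h · x on a realiser of the premise's body; the
-- meta-level (V2) applied to "g x realises φ(x)" concludes. For ECT_V, an almost-negative formula that
-- is realised at all has a realiser computable from its parameters alone (Σ₁ parts by unbounded search
-- for decidable witnesses); feeding it to a realiser of ∀n (φ → ∃m ψ) gives the index e together with
-- realisers of ψ(n, e n).

module Submission where

open import Defs
open import Data.Nat using (ℕ; zero; suc; pred; _+_; _*_; _∸_; _≤_; _<_; z≤n; s≤s; s≤s⁻¹)
open import Data.Nat.Properties
  using (*-identityˡ; *-suc; *-zeroʳ; +-comm; +-identityʳ; +-monoʳ-≤; +-suc; +-∸-assoc; 0∸n≡0; 0≢1+n; 1+n≢0;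
         <-cmp; <⇒≢; m*n≡0⇒m≡0∨n≡0; m+[n∸m]≡n; m+n∸n≡m; m+n≡0⇒m≡0; m+n≡0⇒n≡0; m<n⇒m<1+n; m∸n≡0⇒m≤n;
         m≤n+m; m≤n⇒m<n∨m≡n; m≤n⇒m≤1+n; n∸n≡0; pred[m∸n]≡m∸[1+n]; suc-injective; ≤-antisym; ≤-refl)
open import Data.Fin using (Fin; zero; suc; #_)
open import Data.Vec using (Vec; []; _∷_; tabulate)
open import Data.List using (List; []; _∷_; length; _++_)
open import Data.List.Relation.Unary.Any using (here; there)
open import Data.List.Membership.Propositional using (_∈_)
open import Data.List.Membership.Propositional.Properties using (∈-++⁺ˡ; ∈-++⁺ʳ)
open import Data.Product using (∃-syntax; _×_; _,_; proj₁; proj₂)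
open import Data.Product.Function.NonDependent.Propositional using (_×-⇔_)
open import Data.Sum using (_⊎_; inj₁; inj₂)
open import Data.Sum.Function.Propositional using (_⊎-⇔_)
open import Data.Empty using (⊥; ⊥-elim)
open import Function.Bundles using (_⇔_; mk⇔; Equivalence)
open import Function.Construct.Identity using (⇔-id)
open import Function.Related.TypeIsomorphisms using (→-cong-⇔)
open import Relation.Binary.Definitions using (tri<; tri≈; tri>)
open import Relation.Binary.PropositionalEquality
  using (_≡_; _≢_; refl; sym; trans; cong; cong₂; subst; subst₂; module ≡-Reasoning)
open ≡-Reasoning

unpair-tri+ : ∀ s b → b ≤ s → unpair (tri s + b) ≡ (s ∸ b , b)
unpair-tri+ zero zero z≤n = refl
unpair-tri+ (suc s) zero z≤n = trans (cong unpair next-diagonal) (step (unpair-tri+ s s ≤-refl))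
  where
  next-diagonal : tri s + suc s + 0 ≡ suc (tri s + s)
  next-diagonal = trans (+-identityʳ _) (+-suc (tri s) s)
  step : unpair (tri s + s) ≡ (s ∸ s , s) → unpair (suc (tri s + s)) ≡ (suc s , 0)
  step eq rewrite eq | n∸n≡0 s = refl
unpair-tri+ (suc s) (suc b) (s≤s b≤s) =
  trans (cong unpair (+-suc (tri s + suc s) b)) (step (unpair-tri+ (suc s) b (m≤n⇒m≤1+n b≤s)))
  where
  step : unpair (tri s + suc s + b) ≡ (suc s ∸ b , b) → unpair (suc (tri s + suc s + b)) ≡ (s ∸ b , suc b)
  step eq rewrite eq | +-∸-assoc 1 b≤s = refl

unpair-pair : ∀ a b → unpair (pair a b) ≡ (a , b)
unpair-pair a b rewrite unpair-tri+ (a + b) b (m≤n+m b a) | m+n∸n≡m a b = refl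

pL-pair : ∀ a b → pL (pair a b) ≡ a
pL-pair a b = cong proj₁ (unpair-pair a b)

pR-pair : ∀ a b → pR (pair a b) ≡ b
pR-pair a b = cong proj₂ (unpair-pair a b)

pair-pL-pR : ∀ n → pair (pL n) (pR n) ≡ n
pair-pL-pR zero = refl
pair-pL-pR (suc n) with unpair n | pair-pL-pR n
... | zero , b | eq rewrite +-identityʳ b | +-identityʳ (tri b + suc b) | +-suc (tri b) b = cong suc eq
... | suc a , b | eq rewrite +-suc a b | +-suc (tri (suc (a + b))) b = cong suc eq

pL-pR-pair : ∀ t a b → pL (pR (pair t (pair a b))) ≡ a
pL-pR-pair t a b = trans (cong pL (pR-pair t _)) (pL-pair a b)

pR-pR-pair : ∀ t a b → pR (pR (pair t (pair a b))) ≡ b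
pR-pR-pair t a b = trans (cong pR (pR-pair t _)) (pR-pair a b)

-- Kleene application is functional: the tag pL e determines the only rule that can derive e · n ≃ m.

ApplicationStep : ℕ → ℕ → ℕ → ℕ → Set
ApplicationStep 0 e n m = m ≡ 0
ApplicationStep 1 e n m = m ≡ suc n
ApplicationStep 2 e n m = m ≡ n
ApplicationStep 3 e n m = m ≡ pL n
ApplicationStep 4 e n m = m ≡ pR n
ApplicationStep 5 e n m = ∃[ k ] (pR (pR e) · n ≃ k × pL (pR e) · k ≃ m)
ApplicationStep 6 e n m = ∃[ a ] ∃[ b ] (pL (pR e) · n ≃ a × pR (pR e) · n ≃ b × m ≡ pair a b)
ApplicationStep 7 e n m =
  (pR n ≡ 0 × pL (pR e) · pL n ≃ m)
  ⊎ ∃[ y ] ∃[ r ] (pR n ≡ suc y × e · pair (pL n) y ≃ r × pR (pR e) · pair (pair (pL n) y) r ≃ m)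
ApplicationStep 8 e n m = pR e · pair n m ≃ 0 × (∀ z → z < m → ∃[ w ] (pR e · pair n z ≃ suc w))
ApplicationStep _ e n m = ⊥

application-step : ∀ {e n m} → e · n ≃ m → ApplicationStep (pL e) e n m
application-step {e} {n} d = go d refl
  where
  go : ∀ {m t} → e · n ≃ m → pL e ≡ t → ApplicationStep t e n m
  go (ap-zero p)          refl rewrite p = refl
  go (ap-succ p)          refl rewrite p = refl
  go (ap-id p)            refl rewrite p = refl
  go (ap-left p)          refl rewrite p = refl
  go (ap-right p)         refl rewrite p = refl
  go (ap-comp p d₁ d₂)    refl rewrite p = _ , d₁ , d₂
  go (ap-pair p d₁ d₂)    refl rewrite p = _ , _ , d₁ , d₂ , refl
  go (ap-rec0 p z d₁)     refl rewrite p = inj₁ (z , d₁)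
  go (ap-recS p s d₁ d₂)  refl rewrite p = inj₂ (_ , _ , s , d₁ , d₂)
  go (ap-min p d₁ f)      refl rewrite p = d₁ , f

application-step-at : ∀ {e n m t} → pL e ≡ t → e · n ≃ m → ApplicationStep t e n m
application-step-at {e} {n} {m} p d = subst (λ t → ApplicationStep t e n m) p (application-step d)

·-functional : ∀ {e n a b} → e · n ≃ a → e · n ≃ b → a ≡ b
·-functional (ap-zero p)  d = sym (application-step-at p d)
·-functional (ap-succ p)  d = sym (application-step-at p d)
·-functional (ap-id p)    d = sym (application-step-at p d)
·-functional (ap-left p)  d = sym (application-step-at p d)
·-functional (ap-right p) d = sym (application-step-at p d)
·-functional (ap-comp p d₁ d₂) d with application-step-at p d
... | _ , d₁′ , d₂′ with ·-functional d₁ d₁′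
...   | refl = ·-functional d₂ d₂′
·-functional (ap-pair p d₁ d₂) d with application-step-at p d
... | _ , _ , d₁′ , d₂′ , refl = cong₂ pair (·-functional d₁ d₁′) (·-functional d₂ d₂′)
·-functional (ap-rec0 p z d₁) d with application-step-at p d
... | inj₁ (_ , d₁′)           = ·-functional d₁ d₁′
... | inj₂ (_ , _ , s , _)     = ⊥-elim (0≢1+n (trans (sym z) s))
·-functional (ap-recS p s d₁ d₂) d with application-step-at p d
... | inj₁ (z , _) = ⊥-elim (0≢1+n (trans (sym z) s))
... | inj₂ (_ , _ , s′ , d₁′ , d₂′) with suc-injective (trans (sym s) s′)
...   | refl with ·-functional d₁ d₁′
...     | refl = ·-functional d₂ d₂′
·-functional (ap-min {y = y} p d₀ f) d with application-step-at p d
... | d₀′ , f′ with <-cmp y _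
...   | tri≈ _ eq _ = eq
...   | tri< y<y′ _ _ = ⊥-elim (0≢1+n (·-functional d₀ (proj₂ (f′ y y<y′))))
...   | tri> _ _ y′<y with f _ y′<y
...     | _ , d₀″ = ⊥-elim (1+n≢0 (·-functional d₀″ d₀′))

≃-respˡ : ∀ {e e′ n m} → e ≡ e′ → e · n ≃ m → e′ · n ≃ m
≃-respˡ refl d = d

≃-respʳ : ∀ {e n m m′} → m ≡ m′ → e · n ≃ m → e · n ≃ m′
≃-respʳ refl d = d

-- Codes are opaque so that typechecking never computes their (huge) numerical values.
opaque
  cZero cSuc cId cLeft cRight : ℕ
  cZero  = pair 0 0
  cSuc   = pair 1 0
  cId    = pair 2 0
  cLeft  = pair 3 0
  cRight = pair 4 0

  cComp cPair cRec : ℕ → ℕ → ℕ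
  cComp f g = pair 5 (pair f g)
  cPair f g = pair 6 (pair f g)
  cRec  f g = pair 7 (pair f g)

  cMin : ℕ → ℕ
  cMin f = pair 8 f

  cComp-def : ∀ f g → cComp f g ≡ pair 5 (pair f g)
  cComp-def f g = refl

  cPair-def : ∀ f g → cPair f g ≡ pair 6 (pair f g)
  cPair-def f g = refl

  cZero-· : ∀ {n} → cZero · n ≃ 0
  cZero-· = ap-zero (pL-pair 0 0)

  cSuc-· : ∀ {n} → cSuc · n ≃ suc n
  cSuc-· = ap-succ (pL-pair 1 0)

  cId-· : ∀ {n} → cId · n ≃ n
  cId-· = ap-id (pL-pair 2 0)

  cLeft-· : ∀ {n} → cLeft · n ≃ pL n
  cLeft-· = ap-left (pL-pair 3 0)

  cRight-· : ∀ {n} → cRight · n ≃ pR n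
  cRight-· = ap-right (pL-pair 4 0)

  cComp-· : ∀ {f g n m k} → g · n ≃ m → f · m ≃ k → cComp f g · n ≃ k
  cComp-· {f} {g} d₁ d₂ = ap-comp (pL-pair 5 (pair f g))
    (≃-respˡ (sym (pR-pR-pair 5 f g)) d₁) (≃-respˡ (sym (pL-pR-pair 5 f g)) d₂)

  cPair-· : ∀ {f g n a b} → f · n ≃ a → g · n ≃ b → cPair f g · n ≃ pair a b
  cPair-· {f} {g} d₁ d₂ = ap-pair (pL-pair 6 (pair f g))
    (≃-respˡ (sym (pL-pR-pair 6 f g)) d₁) (≃-respˡ (sym (pR-pR-pair 6 f g)) d₂)

  cRec-·-zero : ∀ {f g x k} → f · x ≃ k → cRec f g · pair x 0 ≃ k
  cRec-·-zero {f} {g} {x} d = ap-rec0 (pL-pair 7 (pair f g)) (pR-pair x 0)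
    (subst₂ (λ c w → c · w ≃ _) (sym (pL-pR-pair 7 f g)) (sym (pL-pair x 0)) d)

  cRec-·-suc : ∀ {f g x y r k} → cRec f g · pair x y ≃ r → g · pair (pair x y) r ≃ k →
               cRec f g · pair x (suc y) ≃ k
  cRec-·-suc {f} {g} {x} {y} d₁ d₂ = ap-recS (pL-pair 7 (pair f g)) (pR-pair x (suc y))
    (subst (λ w → _ · pair w y ≃ _) (sym (pL-pair x (suc y))) d₁)
    (subst₂ (λ c w → c · pair (pair w y) _ ≃ _) (sym (pR-pR-pair 7 f g)) (sym (pL-pair x (suc y))) d₂)

  cMin-· : ∀ {f n y} → f · pair n y ≃ 0 → (∀ z → z < y → ∃[ w ] (f · pair n z ≃ suc w)) →
           cMin f · n ≃ y
  cMin-· {f} d h = ap-min (pL-pair 8 f) (≃-respˡ (sym (pR-pair 8 f)) d)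
    (λ z z<y → proj₁ (h z z<y) , ≃-respˡ (sym (pR-pair 8 f)) (proj₂ (h z z<y)))

recN : ℕ → (ℕ → ℕ → ℕ) → ℕ → ℕ
recN b s zero    = b
recN b s (suc y) = s y (recN b s y)

recN-cong : ∀ {b b′} {s s′ : ℕ → ℕ → ℕ} → b ≡ b′ → (∀ y r → s y r ≡ s′ y r) →
            ∀ n → recN b s n ≡ recN b′ s′ n
recN-cong eb es zero    = eb
recN-cong {s = s} eb es (suc n) = trans (cong (s n) (recN-cong eb es n)) (es n _)

-- A decidable condition is represented by a number that is 0 exactly when the condition holds.

eqN : ℕ → ℕ → ℕ
eqN a b = (a ∸ b) + (b ∸ a)

opaque
  andN : ℕ → ℕ → ℕ
  andN a b = a + b

  andN-def : ∀ a b → andN a b ≡ a + b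
  andN-def a b = refl

selN : ℕ → ℕ → ℕ → ℕ
selN zero    a b = a
selN (suc _) a b = b

allN : ℕ → (ℕ → ℕ) → ℕ
allN b f = recN 0 (λ y r → r + f y) b

exN : ℕ → (ℕ → ℕ) → ℕ
exN b f = recN 1 (λ y r → r * f y) b

muN : ℕ → (ℕ → ℕ) → ℕ
muN b f = recN 0 (λ y r → selN (eqN r y) (selN (f y) y (suc y)) r) b

iterN : ℕ → ℕ → ℕ
iterN l i = recN l (λ _ r → pR r) i

eqN≡0⇒≡ : ∀ a b → eqN a b ≡ 0 → a ≡ b
eqN≡0⇒≡ a b h = ≤-antisym (m∸n≡0⇒m≤n (m+n≡0⇒m≡0 (a ∸ b) h)) (m∸n≡0⇒m≤n (m+n≡0⇒n≡0 (a ∸ b) h))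

eqN-refl : ∀ a → eqN a a ≡ 0
eqN-refl a rewrite n∸n≡0 a = refl

≡⇒eqN≡0 : ∀ {a b} → a ≡ b → eqN a b ≡ 0
≡⇒eqN≡0 {a} refl = eqN-refl a

m≡0⇒n≡0⇒m+n≡0 : ∀ {m n} → m ≡ 0 → n ≡ 0 → m + n ≡ 0
m≡0⇒n≡0⇒m+n≡0 refl refl = refl

m≡0⇒m*n≡0 : ∀ {m} n → m ≡ 0 → m * n ≡ 0
m≡0⇒m*n≡0 n refl = refl

n≡0⇒m*n≡0 : ∀ m {n} → n ≡ 0 → m * n ≡ 0
n≡0⇒m*n≡0 m refl = *-zeroʳ m

1*n≡0⇒n≡0 : ∀ {n} → 1 * n ≡ 0 → n ≡ 0
1*n≡0⇒n≡0 {n} h = trans (sym (*-identityˡ n)) h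

n≡0⇒1*n≡0 : ∀ {n} → n ≡ 0 → 1 * n ≡ 0
n≡0⇒1*n≡0 {n} h = trans (*-identityˡ n) h

1∸n≡0⇒n≡suc : ∀ {n} → 1 ∸ n ≡ 0 → ∃[ k ] (n ≡ suc k)
1∸n≡0⇒n≡suc {suc n} _ = n , refl

andN-proj₁ : ∀ {a b} → andN a b ≡ 0 → a ≡ 0
andN-proj₁ {a} {b} h = m+n≡0⇒m≡0 a (trans (sym (andN-def a b)) h)

andN-proj₂ : ∀ {a b} → andN a b ≡ 0 → b ≡ 0
andN-proj₂ {a} {b} h = m+n≡0⇒n≡0 a (trans (sym (andN-def a b)) h)

andN-intro : ∀ {a b} → a ≡ 0 → b ≡ 0 → andN a b ≡ 0
andN-intro {a} {b} p q = trans (andN-def a b) (m≡0⇒n≡0⇒m+n≡0 p q)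

1∸m*n≡0 : ∀ m n → (m ≡ 0 → n ≡ 0) → (1 ∸ m) * n ≡ 0
1∸m*n≡0 zero    n h = trans (+-identityʳ n) (h refl)
1∸m*n≡0 (suc m) n h = cong (_* n) (0∸n≡0 m)

selN≡0 : ∀ d a b → selN d a b ≡ 0 → (d ≡ 0 × a ≡ 0) ⊎ (d ≢ 0 × b ≡ 0)
selN≡0 zero    a b h = inj₁ (refl , h)
selN≡0 (suc d) a b h = inj₂ ((λ ()) , h)

allN-elim : ∀ b f → allN b f ≡ 0 → ∀ i → i < b → f i ≡ 0
allN-elim (suc b) f h i i<b with m≤n⇒m<n∨m≡n (s≤s⁻¹ i<b)
... | inj₁ i<b′ = allN-elim b f (m+n≡0⇒m≡0 (allN b f) h) i i<b′
... | inj₂ refl = m+n≡0⇒n≡0 (allN b f) h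

allN-intro : ∀ b f → (∀ i → i < b → f i ≡ 0) → allN b f ≡ 0
allN-intro zero    f h = refl
allN-intro (suc b) f h = m≡0⇒n≡0⇒m+n≡0 (allN-intro b f (λ i i<b → h i (m<n⇒m<1+n i<b))) (h b ≤-refl)

exN-elim : ∀ b f → exN b f ≡ 0 → ∃[ i ] (i < b × f i ≡ 0)
exN-elim (suc b) f h with m*n≡0⇒m≡0∨n≡0 (exN b f) h
... | inj₁ h′ = let (i , i<b , fi) = exN-elim b f h′ in i , m<n⇒m<1+n i<b , fi
... | inj₂ h′ = b , ≤-refl , h′

exN-intro : ∀ b f i → i < b → f i ≡ 0 → exN b f ≡ 0
exN-intro (suc b) f i i<b fi with m≤n⇒m<n∨m≡n (s≤s⁻¹ i<b)
... | inj₁ i<b′ = m≡0⇒m*n≡0 (f b) (exN-intro b f i i<b′ fi)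
... | inj₂ refl = n≡0⇒m*n≡0 (exN b f) fi

muN-inv : ∀ y f → (muN y f ≡ y × (∀ i → i < y → f i ≢ 0)) ⊎ (muN y f < y × f (muN y f) ≡ 0)
muN-inv zero f = inj₁ (refl , λ i ())
muN-inv (suc y) f with muN-inv y f
... | inj₁ (eq , h) rewrite eq | eqN-refl y with f y in fy
...   | zero  = inj₂ (≤-refl , fy)
...   | suc w = inj₁ (refl , none-below)
  where
  none-below : ∀ i → i < suc y → f i ≢ 0
  none-below i i<sy fi with m≤n⇒m<n∨m≡n (s≤s⁻¹ i<sy)
  ... | inj₁ i<y = h i i<y fi
  ... | inj₂ refl = 0≢1+n (trans (sym fi) fy)
muN-inv (suc y) f | inj₂ (lt , fz) with eqN (muN y f) y in eq
... | zero  = ⊥-elim (<⇒≢ lt (eqN≡0⇒≡ _ _ eq))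
... | suc w = inj₂ (m<n⇒m<1+n lt , fz)

muN-found : ∀ b f i → i < b → f i ≡ 0 → muN b f < b × f (muN b f) ≡ 0
muN-found b f i i<b fi with muN-inv b f
... | inj₁ (_ , h) = ⊥-elim (h i i<b fi)
... | inj₂ p       = p

LeastZero : (ℕ → ℕ) → ℕ → Set
LeastZero f y = f y ≡ 0 × (∀ z → z < y → ∃[ w ] (f z ≡ suc w))

least-zero-below : ∀ f b → (∀ z → z < b → ∃[ w ] (f z ≡ suc w)) ⊎ ∃[ y ] LeastZero f y
least-zero-below f zero = inj₁ (λ _ ())
least-zero-below f (suc b) with least-zero-below f b
... | inj₂ found = inj₂ found
... | inj₁ none with f b in fb
...   | zero  = inj₂ (b , fb , none)
...   | suc w = inj₁ extended
  where
  extended : ∀ z → z < suc b → ∃[ w ] (f z ≡ suc w)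
  extended z z<sb with m≤n⇒m<n∨m≡n (s≤s⁻¹ z<sb)
  ... | inj₁ z<b = none z z<b
  ... | inj₂ refl = w , fb

least-zero : ∀ f k → f k ≡ 0 → ∃[ y ] LeastZero f y
least-zero f k fk with least-zero-below f (suc k)
... | inj₂ found = found
... | inj₁ none with none k ≤-refl
...   | _ , fk≡suc = ⊥-elim (0≢1+n (trans (sym fk) fk≡suc))

encEnv : ∀ {n} → Env n → ℕ
encEnv {zero} ρ = 0
encEnv {suc n} ρ = pair (ρ zero) (encEnv (λ i → ρ (suc i)))

data BTerm : ℕ → Set where
  var : ∀ {n} → Fin n → BTerm n
  zB : ∀ {n} → BTerm n
  sB lB rB : ∀ {n} → BTerm n → BTerm n
  pB : ∀ {n} → BTerm n → BTerm n → BTerm n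
  subB : ∀ {n m} → Vec (BTerm n) m → BTerm m → BTerm n
  recB : ∀ {n} → BTerm n → BTerm n → BTerm (suc (suc n)) → BTerm n

evB : ∀ {n} → BTerm n → Env n → ℕ
evBV : ∀ {n m} → Vec (BTerm n) m → Env n → Env m
evB (var i) ρ = ρ i
evB zB ρ = 0
evB (sB e) ρ = suc (evB e ρ)
evB (lB e) ρ = pL (evB e ρ)
evB (rB e) ρ = pR (evB e ρ)
evB (pB a b) ρ = pair (evB a ρ) (evB b ρ)
evB (subB vs e) ρ = evB e (evBV vs ρ)
evB (recB bd b s) ρ = recN (evB b ρ) (λ y r → evB s (r ∷ρ (y ∷ρ ρ))) (evB bd ρ)
evBV (x ∷ xs) ρ zero = evB x ρ
evBV (x ∷ xs) ρ (suc i) = evBV xs ρ i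

cProj : ∀ {n} → Fin n → ℕ
cProj zero = cLeft
cProj (suc i) = cComp (cProj i) cRight

cShuffle : ℕ
cShuffle = cPair cRight (cPair (cComp cRight cLeft) (cComp cLeft cLeft))

cB : ∀ {n} → BTerm n → ℕ
cBV : ∀ {n m} → Vec (BTerm n) m → ℕ
cB (var i) = cProj i
cB zB = cZero
cB (sB e) = cComp cSuc (cB e)
cB (lB e) = cComp cLeft (cB e)
cB (rB e) = cComp cRight (cB e)
cB (pB a b) = cPair (cB a) (cB b)
cB (subB vs e) = cComp (cB e) (cBV vs)
cB (recB bd b s) = cComp (cRec (cB b) (cComp (cB s) cShuffle)) (cPair cId (cB bd))
cBV [] = cZero
cBV (x ∷ xs) = cPair (cB x) (cBV xs)

cProj-· : ∀ {n} (i : Fin n) (ρ : Env n) → cProj i · encEnv ρ ≃ ρ i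
cProj-· zero ρ = ≃-respʳ (pL-pair (ρ zero) (encEnv (λ j → ρ (suc j)))) cLeft-·
cProj-· (suc i) ρ =
  cComp-· (≃-respʳ (pR-pair (ρ zero) (encEnv (λ j → ρ (suc j)))) cRight-·) (cProj-· i (λ j → ρ (suc j)))

cShuffle-· : ∀ {x y r} → cShuffle · pair (pair x y) r ≃ pair r (pair y x)
cShuffle-· {x} {y} {r} = cPair-· (≃-respʳ (pR-pair (pair x y) r) cRight-·)
  (cPair-· (cComp-· cLeft-· (≃-respʳ (trans (cong pR (pL-pair (pair x y) r)) (pR-pair x y)) cRight-·))
           (cComp-· cLeft-· (≃-respʳ (trans (cong pL (pL-pair (pair x y) r)) (pL-pair x y)) cLeft-·)))

cB-· : ∀ {n} (e : BTerm n) (ρ : Env n) → cB e · encEnv ρ ≃ evB e ρ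
cBV-· : ∀ {n m} (vs : Vec (BTerm n) m) (ρ : Env n) → cBV vs · encEnv ρ ≃ encEnv (evBV vs ρ)
cB-· (var i) ρ = cProj-· i ρ
cB-· zB ρ = cZero-·
cB-· (sB e) ρ = cComp-· (cB-· e ρ) cSuc-·
cB-· (lB e) ρ = cComp-· (cB-· e ρ) cLeft-·
cB-· (rB e) ρ = cComp-· (cB-· e ρ) cRight-·
cB-· (pB a b) ρ = cPair-· (cB-· a ρ) (cB-· b ρ)
cB-· (subB vs e) ρ = cComp-· (cBV-· vs ρ) (cB-· e (evBV vs ρ))
cB-· (recB bd b s) ρ = cComp-· (cPair-· cId-· (cB-· bd ρ)) (iterate (evB bd ρ))
  where
  step : ℕ → ℕ → ℕ
  step y r = evB s (r ∷ρ (y ∷ρ ρ))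
  iterate : ∀ y → cRec (cB b) (cComp (cB s) cShuffle) · pair (encEnv ρ) y ≃ recN (evB b ρ) step y
  iterate zero    = cRec-·-zero (cB-· b ρ)
  iterate (suc y) = cRec-·-suc {x = encEnv ρ} {y = y} (iterate y)
    (cComp-· (cShuffle-· {encEnv ρ} {y} {recN (evB b ρ) step y}) (cB-· s (recN (evB b ρ) step y ∷ρ (y ∷ρ ρ))))
cBV-· [] ρ = cZero-·
cBV-· (x ∷ xs) ρ = cPair-· (cB-· x ρ) (cBV-· xs ρ)

∷ρ-ext : ∀ {n} {ρ ρ′ : Env n} (k : ℕ) → (∀ i → ρ i ≡ ρ′ i) → ∀ i → (k ∷ρ ρ) i ≡ (k ∷ρ ρ′) i
∷ρ-ext k h zero    = refl
∷ρ-ext k h (suc i) = h i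

evB-ext : ∀ {n} (e : BTerm n) {ρ ρ′ : Env n} → (∀ i → ρ i ≡ ρ′ i) → evB e ρ ≡ evB e ρ′
evBV-ext : ∀ {n m} (vs : Vec (BTerm n) m) {ρ ρ′ : Env n} → (∀ i → ρ i ≡ ρ′ i) → ∀ i → evBV vs ρ i ≡ evBV vs ρ′ i
evB-ext (var i) h = h i
evB-ext zB h = refl
evB-ext (sB e) h = cong suc (evB-ext e h)
evB-ext (lB e) h = cong pL (evB-ext e h)
evB-ext (rB e) h = cong pR (evB-ext e h)
evB-ext (pB a b) h = cong₂ pair (evB-ext a h) (evB-ext b h)
evB-ext (subB vs e) h = evB-ext e (evBV-ext vs h)
evB-ext (recB bd b s) {ρ} {ρ′} h = trans (cong (recN (evB b ρ) (λ y r → evB s (r ∷ρ (y ∷ρ ρ)))) (evB-ext bd h))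
  (recN-cong (evB-ext b h) (λ y r → evB-ext s (∷ρ-ext r (∷ρ-ext y h))) (evB bd ρ′))
evBV-ext (x ∷ xs) h zero = evB-ext x h
evBV-ext (x ∷ xs) h (suc i) = evBV-ext xs h i

evBV-tabulate : ∀ {n m} (f : Fin m → BTerm n) (ρ : Env n) (i : Fin m) → evBV (tabulate f) ρ i ≡ evB (f i) ρ
evBV-tabulate f ρ zero = refl
evBV-tabulate f ρ (suc i) = evBV-tabulate (λ j → f (suc j)) ρ i

renB : ∀ {n m} → (Fin m → Fin n) → BTerm m → BTerm n
renB r e = subB (tabulate (λ i → var (r i))) e

evB-renB : ∀ {n m} (r : Fin m → Fin n) (e : BTerm m) (ρ : Env n) → evB (renB r e) ρ ≡ evB e (λ i → ρ (r i))
evB-renB r e ρ = evB-ext e (evBV-tabulate (λ i → var (r i)) ρ)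

litB : ∀ {n} → ℕ → BTerm n
litB zero = zB
litB (suc k) = sB (litB k)

evB-litB : ∀ {n} k (ρ : Env n) → evB (litB k) ρ ≡ k
evB-litB zero ρ = refl
evB-litB (suc k) ρ = cong suc (evB-litB k ρ)

addB monusB mulB eqB : BTerm 2
predB : BTerm 1
selB : BTerm 3

_+ᴮ_ _∸ᴮ_ _*ᴮ_ eqᴮ : ∀ {n} → BTerm n → BTerm n → BTerm n
a +ᴮ b = subB (a ∷ b ∷ []) addB
a ∸ᴮ b = subB (a ∷ b ∷ []) monusB
a *ᴮ b = subB (a ∷ b ∷ []) mulB
eqᴮ a b = subB (a ∷ b ∷ []) eqB

selᴮ : ∀ {n} → BTerm n → BTerm n → BTerm n → BTerm n
selᴮ c a b = subB (c ∷ a ∷ b ∷ []) selB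

addB   = recB (var (# 1)) (var (# 0)) (sB (var (# 0)))
predB  = recB (var (# 0)) zB (var (# 1))
monusB = recB (var (# 1)) (var (# 0)) (subB (var (# 0) ∷ []) predB)
mulB   = recB (var (# 1)) zB (var (# 0) +ᴮ var (# 2))
eqB    = (var (# 0) ∸ᴮ var (# 1)) +ᴮ (var (# 1) ∸ᴮ var (# 0))
selB   = recB (var (# 0)) (var (# 1)) (var (# 4))

evB-addB : ∀ ρ → evB addB ρ ≡ ρ (# 0) + ρ (# 1)
evB-addB ρ = go (ρ (# 1))
  where
  go : ∀ b → recN (ρ (# 0)) (λ _ r → suc r) b ≡ ρ (# 0) + b
  go zero    = sym (+-identityʳ _)
  go (suc b) = trans (cong suc (go b)) (sym (+-suc _ b))

evB-+ᴮ : ∀ {n} (a b : BTerm n) ρ → evB (a +ᴮ b) ρ ≡ evB a ρ + evB b ρ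
evB-+ᴮ a b ρ = evB-addB (evBV (a ∷ b ∷ []) ρ)

evB-predB : ∀ ρ → evB predB ρ ≡ pred (ρ (# 0))
evB-predB ρ with ρ (# 0)
... | zero  = refl
... | suc k = refl

evB-monusB : ∀ ρ → evB monusB ρ ≡ ρ (# 0) ∸ ρ (# 1)
evB-monusB ρ = go (ρ (# 1))
  where
  step : ℕ → ℕ → ℕ
  step y r = evB (subB (var (# 0) ∷ []) predB) (r ∷ρ (y ∷ρ ρ))
  go : ∀ b → recN (ρ (# 0)) step b ≡ ρ (# 0) ∸ b
  go zero    = refl
  go (suc b) = begin
    step b (recN (ρ (# 0)) step b) ≡⟨ evB-predB (evBV (var (# 0) ∷ []) (recN (ρ (# 0)) step b ∷ρ (b ∷ρ ρ))) ⟩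
    pred (recN (ρ (# 0)) step b)   ≡⟨ cong pred (go b) ⟩
    pred (ρ (# 0) ∸ b)             ≡⟨ pred[m∸n]≡m∸[1+n] (ρ (# 0)) b ⟩
    ρ (# 0) ∸ suc b                ∎

evB-∸ᴮ : ∀ {n} (a b : BTerm n) ρ → evB (a ∸ᴮ b) ρ ≡ evB a ρ ∸ evB b ρ
evB-∸ᴮ a b ρ = evB-monusB (evBV (a ∷ b ∷ []) ρ)

evB-mulB : ∀ ρ → evB mulB ρ ≡ ρ (# 0) * ρ (# 1)
evB-mulB ρ = go (ρ (# 1))
  where
  step : ℕ → ℕ → ℕ
  step y r = evB (var (# 0) +ᴮ var (# 2)) (r ∷ρ (y ∷ρ ρ))
  go : ∀ b → recN 0 step b ≡ ρ (# 0) * b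
  go zero    = sym (*-zeroʳ (ρ (# 0)))
  go (suc b) = begin
    step b (recN 0 step b)  ≡⟨ evB-+ᴮ (var (# 0)) (var (# 2)) (recN 0 step b ∷ρ (b ∷ρ ρ)) ⟩
    recN 0 step b + ρ (# 0) ≡⟨ cong (_+ ρ (# 0)) (go b) ⟩
    ρ (# 0) * b + ρ (# 0)   ≡⟨ +-comm _ (ρ (# 0)) ⟩
    ρ (# 0) + ρ (# 0) * b   ≡⟨ sym (*-suc (ρ (# 0)) b) ⟩
    ρ (# 0) * suc b         ∎

evB-*ᴮ : ∀ {n} (a b : BTerm n) ρ → evB (a *ᴮ b) ρ ≡ evB a ρ * evB b ρ
evB-*ᴮ a b ρ = evB-mulB (evBV (a ∷ b ∷ []) ρ)

evB-eqB : ∀ ρ → evB eqB ρ ≡ eqN (ρ (# 0)) (ρ (# 1))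
evB-eqB ρ = trans (evB-+ᴮ (var (# 0) ∸ᴮ var (# 1)) (var (# 1) ∸ᴮ var (# 0)) ρ)
                  (cong₂ _+_ (evB-∸ᴮ (var (# 0)) (var (# 1)) ρ) (evB-∸ᴮ (var (# 1)) (var (# 0)) ρ))

evB-eqᴮ : ∀ {n} (a b : BTerm n) ρ → evB (eqᴮ a b) ρ ≡ eqN (evB a ρ) (evB b ρ)
evB-eqᴮ a b ρ = evB-eqB (evBV (a ∷ b ∷ []) ρ)

evB-selB : ∀ ρ → evB selB ρ ≡ selN (ρ (# 0)) (ρ (# 1)) (ρ (# 2))
evB-selB ρ with ρ (# 0)
... | zero  = refl
... | suc k = refl

evB-selᴮ : ∀ {n} (c a b : BTerm n) ρ → evB (selᴮ c a b) ρ ≡ selN (evB c ρ) (evB a ρ) (evB b ρ)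
evB-selᴮ c a b ρ = evB-selB (evBV (c ∷ a ∷ b ∷ []) ρ)

-- Expressions have a definitional semantics evE (so, e.g., evE validE agrees with validN by refl) and
-- compile to primitive recursive terms.
data ETerm : ℕ → Set where
  var : ∀ {n} → Fin n → ETerm n
  lit : ∀ {n} → ℕ → ETerm n
  sE lE rE : ∀ {n} → ETerm n → ETerm n
  pE addE andE subtE mulE eqE iterE : ∀ {n} → ETerm n → ETerm n → ETerm n
  selE : ∀ {n} → ETerm n → ETerm n → ETerm n → ETerm n
  allE exE muE : ∀ {n} → ETerm n → ETerm (suc n) → ETerm n
  recE : ∀ {n} → ETerm n → ETerm n → ETerm (suc (suc n)) → ETerm n
  sbE : ∀ {n m} → Vec (ETerm n) m → ETerm m → ETerm n

evE : ∀ {n} → ETerm n → Env n → ℕ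
evEV : ∀ {n m} → Vec (ETerm n) m → Env n → Env m
evE (var i) ρ = ρ i
evE (lit k) ρ = k
evE (sE e) ρ = suc (evE e ρ)
evE (lE e) ρ = pL (evE e ρ)
evE (rE e) ρ = pR (evE e ρ)
evE (pE a b) ρ = pair (evE a ρ) (evE b ρ)
evE (addE a b) ρ = evE a ρ + evE b ρ
evE (andE a b) ρ = andN (evE a ρ) (evE b ρ)
evE (subtE a b) ρ = evE a ρ ∸ evE b ρ
evE (mulE a b) ρ = evE a ρ * evE b ρ
evE (eqE a b) ρ = eqN (evE a ρ) (evE b ρ)
evE (iterE l i) ρ = iterN (evE l ρ) (evE i ρ)
evE (selE c a b) ρ = selN (evE c ρ) (evE a ρ) (evE b ρ)
evE (allE bd body) ρ = allN (evE bd ρ) (λ i → evE body (i ∷ρ ρ))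
evE (exE bd body) ρ = exN (evE bd ρ) (λ i → evE body (i ∷ρ ρ))
evE (muE bd body) ρ = muN (evE bd ρ) (λ i → evE body (i ∷ρ ρ))
evE (recE bd b s) ρ = recN (evE b ρ) (λ y r → evE s (r ∷ρ (y ∷ρ ρ))) (evE bd ρ)
evE (sbE vs e) ρ = evE e (evEV vs ρ)
evEV (x ∷ xs) ρ zero = evE x ρ
evEV (x ∷ xs) ρ (suc i) = evEV xs ρ i

comp : ∀ {n} → ETerm n → BTerm n
compV : ∀ {n m} → Vec (ETerm n) m → Vec (BTerm n) m
comp (var i)        = var i
comp (lit k)        = litB k
comp (sE e)         = sB (comp e)
comp (lE e)         = lB (comp e)
comp (rE e)         = rB (comp e)
comp (pE a b)       = pB (comp a) (comp b)
comp (addE a b)     = comp a +ᴮ comp b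
comp (andE a b)     = comp a +ᴮ comp b
comp (subtE a b)    = comp a ∸ᴮ comp b
comp (mulE a b)     = comp a *ᴮ comp b
comp (eqE a b)      = eqᴮ (comp a) (comp b)
comp (iterE l i)    = recB (comp i) (comp l) (rB (var zero))
comp (selE c a b)   = selᴮ (comp c) (comp a) (comp b)
comp (allE bd body) = recB (comp bd) zB (var zero +ᴮ renB suc (comp body))
comp (exE bd body)  = recB (comp bd) (litB 1) (var zero *ᴮ renB suc (comp body))
comp (muE bd body)  = recB (comp bd) zB
  (selᴮ (eqᴮ (var zero) (var (# 1))) (selᴮ (renB suc (comp body)) (var (# 1)) (sB (var (# 1)))) (var zero))
comp (recE bd b s)  = recB (comp bd) (comp b) (comp s)
comp (sbE vs e)     = subB (compV vs) (comp e)
compV []       = []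
compV (x ∷ xs) = comp x ∷ compV xs

evB-comp : ∀ {n} (e : ETerm n) (ρ : Env n) → evB (comp e) ρ ≡ evE e ρ
evBV-compV : ∀ {n m} (vs : Vec (ETerm n) m) (ρ : Env n) → ∀ i → evBV (compV vs) ρ i ≡ evEV vs ρ i

evB-renB-suc-comp : ∀ {n} (body : ETerm (suc n)) r y (ρ : Env n) →
                    evB (renB suc (comp body)) (r ∷ρ (y ∷ρ ρ)) ≡ evE body (y ∷ρ ρ)
evB-renB-suc-comp body r y ρ =
  trans (evB-renB suc (comp body) _) (trans (evB-ext (comp body) (λ _ → refl)) (evB-comp body (y ∷ρ ρ)))

evB-comp (var i) ρ       = refl
evB-comp (lit k) ρ       = evB-litB k ρ
evB-comp (sE e) ρ        = cong suc (evB-comp e ρ)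
evB-comp (lE e) ρ        = cong pL (evB-comp e ρ)
evB-comp (rE e) ρ        = cong pR (evB-comp e ρ)
evB-comp (pE a b) ρ      = cong₂ pair (evB-comp a ρ) (evB-comp b ρ)
evB-comp (addE a b) ρ    = trans (evB-+ᴮ (comp a) (comp b) ρ) (cong₂ _+_ (evB-comp a ρ) (evB-comp b ρ))
evB-comp (andE a b) ρ    =
  trans (evB-+ᴮ (comp a) (comp b) ρ) (trans (cong₂ _+_ (evB-comp a ρ) (evB-comp b ρ)) (sym (andN-def _ _)))
evB-comp (subtE a b) ρ   = trans (evB-∸ᴮ (comp a) (comp b) ρ) (cong₂ _∸_ (evB-comp a ρ) (evB-comp b ρ))
evB-comp (mulE a b) ρ    = trans (evB-*ᴮ (comp a) (comp b) ρ) (cong₂ _*_ (evB-comp a ρ) (evB-comp b ρ))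
evB-comp (eqE a b) ρ     = trans (evB-eqᴮ (comp a) (comp b) ρ) (cong₂ eqN (evB-comp a ρ) (evB-comp b ρ))
evB-comp (iterE l i) ρ   = trans (cong (recN (evB (comp l) ρ) (λ _ r → pR r)) (evB-comp i ρ))
  (recN-cong (evB-comp l ρ) (λ _ _ → refl) (evE i ρ))
evB-comp (selE c a b) ρ  = trans (evB-selᴮ (comp c) (comp a) (comp b) ρ)
  (trans (cong₂ (λ x y → selN x y (evB (comp b) ρ)) (evB-comp c ρ) (evB-comp a ρ)) (cong (selN (evE c ρ) (evE a ρ)) (evB-comp b ρ)))
evB-comp (allE bd body) ρ = trans (cong (recN 0 _) (evB-comp bd ρ)) (recN-cong refl step (evE bd ρ))
  where
  step : ∀ y r → evB (var zero +ᴮ renB suc (comp body)) (r ∷ρ (y ∷ρ ρ)) ≡ r + evE body (y ∷ρ ρ)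
  step y r = trans (evB-+ᴮ (var zero) (renB suc (comp body)) (r ∷ρ (y ∷ρ ρ))) (cong (r +_) (evB-renB-suc-comp body r y ρ))
evB-comp (exE bd body) ρ = trans (cong (recN 1 _) (evB-comp bd ρ)) (recN-cong refl step (evE bd ρ))
  where
  step : ∀ y r → evB (var zero *ᴮ renB suc (comp body)) (r ∷ρ (y ∷ρ ρ)) ≡ r * evE body (y ∷ρ ρ)
  step y r = trans (evB-*ᴮ (var zero) (renB suc (comp body)) (r ∷ρ (y ∷ρ ρ))) (cong (r *_) (evB-renB-suc-comp body r y ρ))
evB-comp (muE bd body) ρ = trans (cong (recN 0 _) (evB-comp bd ρ)) (recN-cong refl step (evE bd ρ))
  where
  body′ : BTerm _
  body′ = renB suc (comp body)
  step : ∀ y r → evB (selᴮ (eqᴮ (var zero) (var (# 1))) (selᴮ body′ (var (# 1)) (sB (var (# 1)))) (var zero)) (r ∷ρ (y ∷ρ ρ))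
                 ≡ selN (eqN r y) (selN (evE body (y ∷ρ ρ)) y (suc y)) r
  step y r = trans (evB-selᴮ (eqᴮ (var zero) (var (# 1))) (selᴮ body′ (var (# 1)) (sB (var (# 1)))) (var zero) (r ∷ρ (y ∷ρ ρ)))
    (cong₂ (λ d s → selN d s r) (evB-eqᴮ (var zero) (var (# 1)) (r ∷ρ (y ∷ρ ρ)))
      (trans (evB-selᴮ body′ (var (# 1)) (sB (var (# 1))) (r ∷ρ (y ∷ρ ρ))) (cong (λ z → selN z y (suc y)) (evB-renB-suc-comp body r y ρ))))
evB-comp (recE bd b s) ρ = trans (cong (recN (evB (comp b) ρ) _) (evB-comp bd ρ))
  (recN-cong (evB-comp b ρ) (λ y r → evB-comp s (r ∷ρ (y ∷ρ ρ))) (evE bd ρ))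
evB-comp (sbE vs e) ρ = trans (evB-ext (comp e) (evBV-compV vs ρ)) (evB-comp e (evEV vs ρ))
evBV-compV (x ∷ xs) ρ zero    = evB-comp x ρ
evBV-compV (x ∷ xs) ρ (suc i) = evBV-compV xs ρ i

cE : ∀ {n} → ETerm n → ℕ
cE e = cB (comp e)

cE-· : ∀ {n} (e : ETerm n) (ρ : Env n) → cE e · encEnv ρ ≃ evE e ρ
cE-· e ρ = ≃-respʳ (evB-comp e ρ) (cB-· (comp e) ρ)

-- A certificate for e · n ≃ m codes a list of judgements starting with it, each following by one rule
-- from later ones. Checking a certificate is primitive recursive, so searching for one is a universal
-- function.
opaque
  judgement : ℕ → ℕ → ℕ → ℕ
  judgement e n m = pair e (pair n m)

jFun jArg jVal : ℕ → ℕ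
jFun x = pL x
jArg x = pL (pR x)
jVal x = pR (pR x)

-- A list x₀, …, x_{k-1} is coded as ⟨k, ⟨x₀, ⟨x₁, …⟩⟩⟩.
entry : ℕ → ℕ → ℕ
entry raw i = pL (iterN raw i)

listedN : ℕ → ℕ → ℕ
listedN L y = exN (pL L) (λ i → eqN (entry (pR L) i) y)

isTagN : ℕ → ℕ → ℕ
isTagN tag k = 1 ∸ eqN tag k

compPremisesN pairPremisesN recPremisesN minPremisesN : ℕ → ℕ → ℕ → ℕ → ℕ
recPremisesAtN : ℕ → ℕ → ℕ → ℕ → ℕ → ℕ

compPremisesN e n m L = exN (pL L) λ i → let x = entry (pR L) i in
  andN (eqN (jFun x) (pR (pR e))) (andN (eqN (jArg x) n) (listedN L (judgement (pL (pR e)) (jVal x) m)))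

pairPremisesN e n m L = exN (pL L) λ i → exN (pL L) λ i′ → let x = entry (pR L) i ; x′ = entry (pR L) i′ in
  andN (eqN (jFun x) (pL (pR e))) (andN (eqN (jArg x) n) (andN (eqN (jFun x′) (pR (pR e)))
    (andN (eqN (jArg x′) n) (eqN m (pair (jVal x) (jVal x′))))))

recPremisesN e n m L = recPremisesAtN (pR n) e n m L

recPremisesAtN rn e n m L =
  andN ((1 ∸ rn) * listedN L (judgement (pL (pR e)) (pL n) m))
       (rn * exN (pL L) λ i → let x = entry (pR L) i in
          andN (eqN (jFun x) e) (andN (eqN (jArg x) (pair (pL n) (rn ∸ 1)))
            (listedN L (judgement (pR (pR e)) (pair (jArg x) (jVal x)) m))))

minPremisesN e n m L =
  andN (listedN L (judgement (pR e) (pair n m) 0))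
       (allN m λ z → exN (pL L) λ i → let x = entry (pR L) i in
          andN (eqN (jFun x) (pR e)) (andN (eqN (jArg x) (pair n z)) (1 ∸ jVal x)))

ruleAtN : ℕ → ℕ → ℕ → ℕ → ℕ → ℕ
ruleAtN tg e n m L =
  andN (1 ∸ (9 ∸ tg)) (
  andN (isTagN tg 0 * m) (
  andN (isTagN tg 1 * eqN m (suc n)) (
  andN (isTagN tg 2 * eqN m n) (
  andN (isTagN tg 3 * eqN m (pL n)) (
  andN (isTagN tg 4 * eqN m (pR n)) (
  andN (isTagN tg 5 * compPremisesN e n m L) (
  andN (isTagN tg 6 * pairPremisesN e n m L) (
  andN (isTagN tg 7 * recPremisesN e n m L)
       (isTagN tg 8 * minPremisesN e n m L)))))))))

ruleN : ℕ → ℕ → ℕ → ℕ → ℕ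
ruleN e n m L = ruleAtN (pL e) e n m L

validEntriesN : ℕ → ℕ → ℕ
validEntriesN len raw = allN len λ i → let x = entry raw i in
  ruleN (jFun x) (jArg x) (jVal x) (pair (len ∸ suc i) (iterN raw (suc i)))

validN : ℕ → ℕ
validN t = validEntriesN (pL t) (pR t)

jFunE jArgE jValE : ∀ {n} → ETerm n → ETerm n
jFunE x = lE x
jArgE x = lE (rE x)
jValE x = rE (rE x)

judgementE : ∀ {n} → ETerm n → ETerm n → ETerm n → ETerm n
judgementE e n m = pE e (pE n m)

entryE : ∀ {n} → ETerm n → ETerm n → ETerm n
entryE raw i = lE (iterE raw i)

listedE : ∀ {n} → ETerm n → ETerm n → ETerm n
listedE L y = sbE (L ∷ y ∷ []) (exE (lE (var (# 0))) (eqE (entryE (rE (var (# 1))) (var (# 0))) (var (# 2))))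

isTagE : ∀ {n} → ETerm n → ℕ → ETerm n
isTagE tag k = subtE (lit 1) (eqE tag (lit k))

ruleE : ETerm 4
ruleE =
  andE (subtE (lit 1) (subtE (lit 9) (lE e))) (
  andE (mulE (isTagE (lE e) 0) m) (
  andE (mulE (isTagE (lE e) 1) (eqE m (sE n))) (
  andE (mulE (isTagE (lE e) 2) (eqE m n)) (
  andE (mulE (isTagE (lE e) 3) (eqE m (lE n))) (
  andE (mulE (isTagE (lE e) 4) (eqE m (rE n))) (
  andE (mulE (isTagE (lE e) 5) compPremises) (
  andE (mulE (isTagE (lE e) 6) pairPremises) (
  andE (mulE (isTagE (lE e) 7) recPremises)
       (mulE (isTagE (lE e) 8) minPremises)))))))))
  where
  e n m L : ETerm 4
  e = var (# 0)
  n = var (# 1)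
  m = var (# 2)
  L = var (# 3)
  e₁ n₁ m₁ L₁ x₁ : ETerm 5
  e₁ = var (# 1)
  n₁ = var (# 2)
  m₁ = var (# 3)
  L₁ = var (# 4)
  x₁ = entryE (rE L₁) (var (# 0))
  x₂ x₂′ : ETerm 6
  x₂  = entryE (rE (var (# 5))) (var (# 1))
  x₂′ = entryE (rE (var (# 5))) (var (# 0))
  compPremises pairPremises recPremises minPremises : ETerm 4
  compPremises = exE (lE L)
    (andE (eqE (jFunE x₁) (rE (rE e₁))) (andE (eqE (jArgE x₁) n₁) (listedE L₁ (judgementE (lE (rE e₁)) (jValE x₁) m₁))))
  pairPremises = exE (lE L) (exE (lE L₁)
    (andE (eqE (jFunE x₂) (lE (rE (var (# 2))))) (andE (eqE (jArgE x₂) (var (# 3))) (andE (eqE (jFunE x₂′) (rE (rE (var (# 2)))))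
      (andE (eqE (jArgE x₂′) (var (# 3))) (eqE (var (# 4)) (pE (jValE x₂) (jValE x₂′))))))))
  recPremises =
    andE (mulE (subtE (lit 1) (rE n)) (listedE L (judgementE (lE (rE e)) (lE n) m)))
         (mulE (rE n) (exE (lE L) (andE (eqE (jFunE x₁) e₁) (andE (eqE (jArgE x₁) (pE (lE n₁) (subtE (rE n₁) (lit 1))))
           (listedE L₁ (judgementE (rE (rE e₁)) (pE (jArgE x₁) (jValE x₁)) m₁))))))
  minPremises =
    andE (listedE L (judgementE (rE e) (pE n m) (lit 0)))
         (allE m (exE (lE L₁) (andE (eqE (jFunE x₂′) (rE (var (# 2))))
           (andE (eqE (jArgE x₂′) (pE (var (# 3)) (var (# 1)))) (subtE (lit 1) (jValE x₂′))))))

validE : ETerm 1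
validE = allE (lE (var (# 0)))
  (sbE (jFunE x ∷ jArgE x ∷ jValE x ∷ pE (subtE (lE (var (# 1))) (sE (var (# 0)))) (iterE (rE (var (# 1))) (sE (var (# 0)))) ∷ [])
       ruleE)
  where
  x : ETerm 2
  x = entryE (rE (var (# 1))) (var (# 0))

Holds : ℕ → Set
Holds x = jFun x · jArg x ≃ jVal x

Listed : ℕ → ℕ → Set
Listed L y = ∃[ i ] (i < pL L × entry (pR L) i ≡ y)

-- The rules of _·_≃_, with premises replaced by judgements satisfying P.
data Rule (P : ℕ → Set) (e n m : ℕ) : Set where
  rule-zero  : pL e ≡ 0 → m ≡ 0 → Rule P e n m
  rule-succ  : pL e ≡ 1 → m ≡ suc n → Rule P e n m
  rule-id    : pL e ≡ 2 → m ≡ n → Rule P e n m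
  rule-left  : pL e ≡ 3 → m ≡ pL n → Rule P e n m
  rule-right : pL e ≡ 4 → m ≡ pR n → Rule P e n m
  rule-comp  : pL e ≡ 5 → ∀ k → P (judgement (pR (pR e)) n k) → P (judgement (pL (pR e)) k m) → Rule P e n m
  rule-pair  : pL e ≡ 6 → ∀ a b → P (judgement (pL (pR e)) n a) → P (judgement (pR (pR e)) n b) →
               m ≡ pair a b → Rule P e n m
  rule-rec0  : pL e ≡ 7 → pR n ≡ 0 → P (judgement (pL (pR e)) (pL n) m) → Rule P e n m
  rule-recS  : pL e ≡ 7 → ∀ y r → pR n ≡ suc y → P (judgement e (pair (pL n) y) r) →
               P (judgement (pR (pR e)) (pair (pair (pL n) y) r) m) → Rule P e n m
  rule-min   : pL e ≡ 8 → P (judgement (pR e) (pair n m) 0) →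
               (∀ z → z < m → ∃[ w ] P (judgement (pR e) (pair n z) (suc w))) → Rule P e n m

opaque
  unfolding judgement
  jFun-judgement : ∀ a b c → jFun (judgement a b c) ≡ a
  jFun-judgement a b c = pL-pair a (pair b c)
  jArg-judgement : ∀ a b c → jArg (judgement a b c) ≡ b
  jArg-judgement a b c = trans (cong pL (pR-pair a (pair b c))) (pL-pair b c)
  jVal-judgement : ∀ a b c → jVal (judgement a b c) ≡ c
  jVal-judgement a b c = trans (cong pR (pR-pair a (pair b c))) (pR-pair b c)

  judgement-η : ∀ x → judgement (jFun x) (jArg x) (jVal x) ≡ x
  judgement-η x = trans (cong (pair (pL x)) (pair-pL-pR (pR x))) (pair-pL-pR x)

Holds-judgement : ∀ {a b c} → Holds (judgement a b c) → a · b ≃ c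
Holds-judgement {a} {b} {c} h rewrite jFun-judgement a b c | jArg-judgement a b c | jVal-judgement a b c = h

Rule-sound : ∀ {P e n m} → Rule P e n m → (∀ y → P y → Holds y) → e · n ≃ m
Rule-sound (rule-zero t refl) H = ap-zero t
Rule-sound (rule-succ t refl) H = ap-succ t
Rule-sound (rule-id t refl) H = ap-id t
Rule-sound (rule-left t refl) H = ap-left t
Rule-sound (rule-right t refl) H = ap-right t
Rule-sound (rule-comp t k p q) H = ap-comp t (Holds-judgement (H _ p)) (Holds-judgement (H _ q))
Rule-sound (rule-pair t a b p q refl) H = ap-pair t (Holds-judgement (H _ p)) (Holds-judgement (H _ q))
Rule-sound (rule-rec0 t z p) H = ap-rec0 t z (Holds-judgement (H _ p))
Rule-sound (rule-recS t y r s p q) H = ap-recS t s (Holds-judgement (H _ p)) (Holds-judgement (H _ q))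
Rule-sound (rule-min t p f) H =
  ap-min t (Holds-judgement (H _ p)) (λ z lt → proj₁ (f z lt) , Holds-judgement (H _ (proj₂ (f z lt))))

Rule-mono : ∀ {P Q : ℕ → Set} {e n m} → (∀ y → P y → Q y) → Rule P e n m → Rule Q e n m
Rule-mono f (rule-zero t x) = rule-zero t x
Rule-mono f (rule-succ t x) = rule-succ t x
Rule-mono f (rule-id t x) = rule-id t x
Rule-mono f (rule-left t x) = rule-left t x
Rule-mono f (rule-right t x) = rule-right t x
Rule-mono f (rule-comp t k p q) = rule-comp t k (f _ p) (f _ q)
Rule-mono f (rule-pair t a b p q x) = rule-pair t a b (f _ p) (f _ q) x
Rule-mono f (rule-rec0 t z p) = rule-rec0 t z (f _ p)
Rule-mono f (rule-recS t y r s p q) = rule-recS t y r s (f _ p) (f _ q)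
Rule-mono f (rule-min t p g) = rule-min t (f _ p) (λ z lt → proj₁ (g z lt) , f _ (proj₂ (g z lt)))

listedN≡0⇒Listed : ∀ L y → listedN L y ≡ 0 → Listed L y
listedN≡0⇒Listed L y h = let (i , lt , q) = exN-elim (pL L) _ h in i , lt , eqN≡0⇒≡ _ _ q

Listed⇒listedN≡0 : ∀ L y → Listed L y → listedN L y ≡ 0
Listed⇒listedN≡0 L y (i , lt , q) = exN-intro (pL L) _ i lt (≡⇒eqN≡0 q)

Listed-entry : ∀ L i → i < pL L → let x = entry (pR L) i in Listed L (judgement (jFun x) (jArg x) (jVal x))
Listed-entry L i lt = i , lt , sym (judgement-η _)

Listed-judgement : ∀ L a b c → Listed L (judgement a b c) →
                   ∃[ i ] (i < pL L × jFun (entry (pR L) i) ≡ a × jArg (entry (pR L) i) ≡ b × jVal (entry (pR L) i) ≡ c)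
Listed-judgement L a b c (i , lt , q) =
  i , lt , trans (cong jFun q) (jFun-judgement a b c) , trans (cong jArg q) (jArg-judgement a b c) ,
  trans (cong jVal q) (jVal-judgement a b c)

compPremisesN-decode : ∀ e n m L → compPremisesN e n m L ≡ 0 →
                       ∃[ k ] (Listed L (judgement (pR (pR e)) n k) × Listed L (judgement (pL (pR e)) k m))
compPremisesN-decode e n m L h with exN-elim (pL L) _ h
... | i , lt , q = jVal x , subst₂ (λ f a → Listed L (judgement f a (jVal x))) fun arg (Listed-entry L i lt) ,
                   listedN≡0⇒Listed L _ (andN-proj₂ (andN-proj₂ q))
  where
  x = entry (pR L) i
  fun : jFun x ≡ pR (pR e)
  fun = eqN≡0⇒≡ _ _ (andN-proj₁ q)
  arg : jArg x ≡ n
  arg = eqN≡0⇒≡ _ _ (andN-proj₁ (andN-proj₂ q))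

pairPremisesN-decode : ∀ e n m L → pairPremisesN e n m L ≡ 0 →
  ∃[ a ] ∃[ b ] (Listed L (judgement (pL (pR e)) n a) × Listed L (judgement (pR (pR e)) n b) × m ≡ pair a b)
pairPremisesN-decode e n m L h with exN-elim (pL L) _ h
... | i , lt , h′ with exN-elim (pL L) _ h′
... | i′ , lt′ , q = jVal x , jVal x′ ,
  subst₂ (λ f a → Listed L (judgement f a (jVal x))) fun arg (Listed-entry L i lt) ,
  subst₂ (λ f a → Listed L (judgement f a (jVal x′))) fun′ arg′ (Listed-entry L i′ lt′) , val
  where
  x = entry (pR L) i
  x′ = entry (pR L) i′
  fun : jFun x ≡ pL (pR e)
  fun = eqN≡0⇒≡ _ _ (andN-proj₁ q)
  arg : jArg x ≡ n
  arg = eqN≡0⇒≡ _ _ (andN-proj₁ (andN-proj₂ q))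
  fun′ : jFun x′ ≡ pR (pR e)
  fun′ = eqN≡0⇒≡ _ _ (andN-proj₁ (andN-proj₂ (andN-proj₂ q)))
  arg′ : jArg x′ ≡ n
  arg′ = eqN≡0⇒≡ _ _ (andN-proj₁ (andN-proj₂ (andN-proj₂ (andN-proj₂ q))))
  val : m ≡ pair (jVal x) (jVal x′)
  val = eqN≡0⇒≡ _ _ (andN-proj₂ (andN-proj₂ (andN-proj₂ (andN-proj₂ q))))

recPremisesAtN-decode : ∀ rn e n m L → pL e ≡ 7 → pR n ≡ rn → recPremisesAtN rn e n m L ≡ 0 → Rule (Listed L) e n m
recPremisesAtN-decode zero e n m L t r h = rule-rec0 t r (listedN≡0⇒Listed L _ (1*n≡0⇒n≡0 (andN-proj₁ h)))
recPremisesAtN-decode (suc y) e n m L t r h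
  with m*n≡0⇒m≡0∨n≡0 (suc y) (andN-proj₂ {(0 ∸ y) * listedN L (judgement (pL (pR e)) (pL n) m)} h)
... | inj₂ h′ with exN-elim (pL L) _ h′
... | i , lt , q = rule-recS t y (jVal x) r (subst₂ (λ f a → Listed L (judgement f a (jVal x))) fun arg (Listed-entry L i lt))
                     (subst (λ a → Listed L (judgement (pR (pR e)) (pair a (jVal x)) m)) arg
                       (listedN≡0⇒Listed L _ (andN-proj₂ (andN-proj₂ q))))
  where
  x = entry (pR L) i
  fun : jFun x ≡ e
  fun = eqN≡0⇒≡ _ _ (andN-proj₁ q)
  arg : jArg x ≡ pair (pL n) y
  arg = eqN≡0⇒≡ _ _ (andN-proj₁ (andN-proj₂ q))

minPremisesN-decode : ∀ e n m L → pL e ≡ 8 → minPremisesN e n m L ≡ 0 → Rule (Listed L) e n m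
minPremisesN-decode e n m L t h = rule-min t (listedN≡0⇒Listed L _ (andN-proj₁ h)) earlier
  where
  earlier : ∀ z → z < m → ∃[ w ] Listed L (judgement (pR e) (pair n z) (suc w))
  earlier z lt with exN-elim (pL L) _ (allN-elim m _ (andN-proj₂ h) z lt)
  ... | i , lt′ , q with 1∸n≡0⇒n≡suc (andN-proj₂ (andN-proj₂ q))
  ...   | w , val = w , subst₂ (λ f a → Listed L (judgement f a (suc w))) fun arg
                          (subst (λ v → Listed L (judgement (jFun x) (jArg x) v)) val (Listed-entry L i lt′))
    where
    x = entry (pR L) i
    fun : jFun x ≡ pR e
    fun = eqN≡0⇒≡ _ _ (andN-proj₁ q)
    arg : jArg x ≡ pair n z
    arg = eqN≡0⇒≡ _ _ (andN-proj₁ (andN-proj₂ q))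

module _ (tg e n m L : ℕ) (h : ruleAtN tg e n m L ≡ 0) where
  tag<9 : 1 ∸ (9 ∸ tg) ≡ 0
  tag<9 = andN-proj₁ h
  case-zero : isTagN tg 0 * m ≡ 0
  case-zero = andN-proj₁ (andN-proj₂ h)
  case-succ : isTagN tg 1 * eqN m (suc n) ≡ 0
  case-succ = andN-proj₁ (andN-proj₂ (andN-proj₂ h))
  case-id : isTagN tg 2 * eqN m n ≡ 0
  case-id = andN-proj₁ (andN-proj₂ (andN-proj₂ (andN-proj₂ h)))
  case-left : isTagN tg 3 * eqN m (pL n) ≡ 0
  case-left = andN-proj₁ (andN-proj₂ (andN-proj₂ (andN-proj₂ (andN-proj₂ h))))
  case-right : isTagN tg 4 * eqN m (pR n) ≡ 0
  case-right = andN-proj₁ (andN-proj₂ (andN-proj₂ (andN-proj₂ (andN-proj₂ (andN-proj₂ h)))))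
  case-comp : isTagN tg 5 * compPremisesN e n m L ≡ 0
  case-comp = andN-proj₁ (andN-proj₂ (andN-proj₂ (andN-proj₂ (andN-proj₂ (andN-proj₂ (andN-proj₂ h))))))
  case-pair : isTagN tg 6 * pairPremisesN e n m L ≡ 0
  case-pair = andN-proj₁ (andN-proj₂ (andN-proj₂ (andN-proj₂ (andN-proj₂ (andN-proj₂ (andN-proj₂ (andN-proj₂ h)))))))
  case-rec : isTagN tg 7 * recPremisesN e n m L ≡ 0
  case-rec = andN-proj₁ (andN-proj₂ (andN-proj₂ (andN-proj₂ (andN-proj₂ (andN-proj₂ (andN-proj₂ (andN-proj₂ (andN-proj₂ h))))))))
  case-min : isTagN tg 8 * minPremisesN e n m L ≡ 0
  case-min = andN-proj₂ (andN-proj₂ (andN-proj₂ (andN-proj₂ (andN-proj₂ (andN-proj₂ (andN-proj₂ (andN-proj₂ (andN-proj₂ h))))))))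

ruleAtN-decode : ∀ tg e n m L → pL e ≡ tg → ruleAtN tg e n m L ≡ 0 → Rule (Listed L) e n m
ruleAtN-decode 0 e n m L t h = rule-zero t (1*n≡0⇒n≡0 (case-zero 0 e n m L h))
ruleAtN-decode 1 e n m L t h = rule-succ t (eqN≡0⇒≡ _ _ (1*n≡0⇒n≡0 (case-succ 1 e n m L h)))
ruleAtN-decode 2 e n m L t h = rule-id t (eqN≡0⇒≡ _ _ (1*n≡0⇒n≡0 (case-id 2 e n m L h)))
ruleAtN-decode 3 e n m L t h = rule-left t (eqN≡0⇒≡ _ _ (1*n≡0⇒n≡0 (case-left 3 e n m L h)))
ruleAtN-decode 4 e n m L t h = rule-right t (eqN≡0⇒≡ _ _ (1*n≡0⇒n≡0 (case-right 4 e n m L h)))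
ruleAtN-decode 5 e n m L t h =
  let k , p , q = compPremisesN-decode e n m L (1*n≡0⇒n≡0 (case-comp 5 e n m L h)) in rule-comp t k p q
ruleAtN-decode 6 e n m L t h =
  let a , b , p , q , v = pairPremisesN-decode e n m L (1*n≡0⇒n≡0 (case-pair 6 e n m L h)) in rule-pair t a b p q v
ruleAtN-decode 7 e n m L t h = recPremisesAtN-decode (pR n) e n m L t refl (1*n≡0⇒n≡0 (case-rec 7 e n m L h))
ruleAtN-decode 8 e n m L t h = minPremisesN-decode e n m L t (1*n≡0⇒n≡0 (case-min 8 e n m L h))
ruleAtN-decode (suc (suc (suc (suc (suc (suc (suc (suc (suc k))))))))) e n m L t h
  with trans (cong (1 ∸_) (sym (0∸n≡0 k))) (tag<9 (9 + k) e n m L h)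
... | ()

ruleN-decode : ∀ e n m L → ruleN e n m L ≡ 0 → Rule (Listed L) e n m
ruleN-decode e n m L h = ruleAtN-decode (pL e) e n m L refl h

ruleAtN-intro : ∀ tg e n m L → 1 ∸ (9 ∸ tg) ≡ 0 → isTagN tg 0 * m ≡ 0 → isTagN tg 1 * eqN m (suc n) ≡ 0 →
  isTagN tg 2 * eqN m n ≡ 0 → isTagN tg 3 * eqN m (pL n) ≡ 0 → isTagN tg 4 * eqN m (pR n) ≡ 0 →
  isTagN tg 5 * compPremisesN e n m L ≡ 0 → isTagN tg 6 * pairPremisesN e n m L ≡ 0 →
  isTagN tg 7 * recPremisesN e n m L ≡ 0 → isTagN tg 8 * minPremisesN e n m L ≡ 0 → ruleAtN tg e n m L ≡ 0
ruleAtN-intro tg e n m L p9 p0 p1 p2 p3 p4 p5 p6 p7 p8 =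
  andN-intro p9 (andN-intro p0 (andN-intro p1 (andN-intro p2 (andN-intro p3
    (andN-intro p4 (andN-intro p5 (andN-intro p6 (andN-intro p7 p8))))))))

compPremisesN-encode : ∀ e n m L k → Listed L (judgement (pR (pR e)) n k) → Listed L (judgement (pL (pR e)) k m) →
                       compPremisesN e n m L ≡ 0
compPremisesN-encode e n m L k p q with Listed-judgement L _ _ _ p
... | i , lt , fun , arg , val = exN-intro (pL L) _ i lt (andN-intro (≡⇒eqN≡0 fun) (andN-intro (≡⇒eqN≡0 arg)
      (Listed⇒listedN≡0 L _ (subst (λ v → Listed L (judgement (pL (pR e)) v m)) (sym val) q))))

pairPremisesN-encode : ∀ e n m L a b → Listed L (judgement (pL (pR e)) n a) → Listed L (judgement (pR (pR e)) n b) →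
                       m ≡ pair a b → pairPremisesN e n m L ≡ 0
pairPremisesN-encode e n m L a b p q mq with Listed-judgement L _ _ _ p | Listed-judgement L _ _ _ q
... | i , lt , fun , arg , val | i′ , lt′ , fun′ , arg′ , val′ = exN-intro (pL L) _ i lt (exN-intro (pL L) _ i′ lt′
      (andN-intro (≡⇒eqN≡0 fun) (andN-intro (≡⇒eqN≡0 arg) (andN-intro (≡⇒eqN≡0 fun′) (andN-intro (≡⇒eqN≡0 arg′)
        (≡⇒eqN≡0 (trans mq (sym (cong₂ pair val val′)))))))))

recPremisesAtN-encode-zero : ∀ e n m L → Listed L (judgement (pL (pR e)) (pL n) m) → recPremisesAtN 0 e n m L ≡ 0
recPremisesAtN-encode-zero e n m L p = andN-intro (n≡0⇒1*n≡0 (Listed⇒listedN≡0 L _ p)) refl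

recPremisesAtN-encode-suc : ∀ e n m L y r → Listed L (judgement e (pair (pL n) y) r) →
                            Listed L (judgement (pR (pR e)) (pair (pair (pL n) y) r) m) → recPremisesAtN (suc y) e n m L ≡ 0
recPremisesAtN-encode-suc e n m L y r p q with Listed-judgement L _ _ _ p
... | i , lt , fun , arg , val = andN-intro (cong (_* listedN L (judgement (pL (pR e)) (pL n) m)) (0∸n≡0 y))
      (n≡0⇒m*n≡0 (suc y) (exN-intro (pL L) _ i lt (andN-intro (≡⇒eqN≡0 fun) (andN-intro (≡⇒eqN≡0 arg)
        (Listed⇒listedN≡0 L _ (subst₂ (λ a v → Listed L (judgement (pR (pR e)) (pair a v) m)) (sym arg) (sym val) q))))))

minPremisesN-encode : ∀ e n m L → Listed L (judgement (pR e) (pair n m) 0) →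
                      (∀ z → z < m → ∃[ w ] Listed L (judgement (pR e) (pair n z) (suc w))) → minPremisesN e n m L ≡ 0
minPremisesN-encode e n m L p f = andN-intro (Listed⇒listedN≡0 L _ p) (allN-intro m _ earlier)
  where
  earlier : ∀ z → z < m → let x = λ i → entry (pR L) i in
            exN (pL L) (λ i → andN (eqN (jFun (x i)) (pR e)) (andN (eqN (jArg (x i)) (pair n z)) (1 ∸ jVal (x i)))) ≡ 0
  earlier z lt with f z lt
  ... | w , listed with Listed-judgement L _ _ _ listed
  ...   | i , lt′ , fun , arg , val =
    exN-intro (pL L) _ i lt′ (andN-intro (≡⇒eqN≡0 fun) (andN-intro (≡⇒eqN≡0 arg) (trans (cong (1 ∸_) val) (0∸n≡0 w))))

ruleN-encode : ∀ e n m L → Rule (Listed L) e n m → ruleN e n m L ≡ 0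
ruleN-encode e n m L r = encode r
  where
  at : ∀ {tg} → pL e ≡ tg → ruleAtN tg e n m L ≡ 0 → ruleN e n m L ≡ 0
  at t = subst (λ tg → ruleAtN tg e n m L ≡ 0) (sym t)
  encode : Rule (Listed L) e n m → ruleN e n m L ≡ 0
  encode (rule-zero t v) = at t (ruleAtN-intro 0 e n m L refl (n≡0⇒1*n≡0 v) refl refl refl refl refl refl refl refl)
  encode (rule-succ t v) =
    at t (ruleAtN-intro 1 e n m L refl refl (n≡0⇒1*n≡0 (≡⇒eqN≡0 v)) refl refl refl refl refl refl refl)
  encode (rule-id t v) =
    at t (ruleAtN-intro 2 e n m L refl refl refl (n≡0⇒1*n≡0 (≡⇒eqN≡0 v)) refl refl refl refl refl refl)
  encode (rule-left t v) =
    at t (ruleAtN-intro 3 e n m L refl refl refl refl (n≡0⇒1*n≡0 (≡⇒eqN≡0 v)) refl refl refl refl refl)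
  encode (rule-right t v) =
    at t (ruleAtN-intro 4 e n m L refl refl refl refl refl (n≡0⇒1*n≡0 (≡⇒eqN≡0 v)) refl refl refl refl)
  encode (rule-comp t k p q) =
    at t (ruleAtN-intro 5 e n m L refl refl refl refl refl refl (n≡0⇒1*n≡0 (compPremisesN-encode e n m L k p q)) refl refl refl)
  encode (rule-pair t a b p q v) =
    at t (ruleAtN-intro 6 e n m L refl refl refl refl refl refl refl (n≡0⇒1*n≡0 (pairPremisesN-encode e n m L a b p q v)) refl refl)
  encode (rule-rec0 t z p) = at t (ruleAtN-intro 7 e n m L refl refl refl refl refl refl refl refl
    (n≡0⇒1*n≡0 (subst (λ rn → recPremisesAtN rn e n m L ≡ 0) (sym z) (recPremisesAtN-encode-zero e n m L p))) refl)
  encode (rule-recS t y r s p q) = at t (ruleAtN-intro 7 e n m L refl refl refl refl refl refl refl refl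
    (n≡0⇒1*n≡0 (subst (λ rn → recPremisesAtN rn e n m L ≡ 0) (sym s) (recPremisesAtN-encode-suc e n m L y r p q))) refl)
  encode (rule-min t p f) =
    at t (ruleAtN-intro 8 e n m L refl refl refl refl refl refl refl refl refl (n≡0⇒1*n≡0 (minPremisesN-encode e n m L p f)))

entries : List ℕ → ℕ
entries []       = 0
entries (x ∷ xs) = pair x (entries xs)

encList : List ℕ → ℕ
encList xs = pair (length xs) (entries xs)

iterN-suc : ∀ l i → iterN l (suc i) ≡ iterN (pR l) i
iterN-suc l zero    = refl
iterN-suc l (suc i) = cong pR (iterN-suc l i)

entry-suc : ∀ x r i → entry (pair x r) (suc i) ≡ entry r i
entry-suc x r i = cong pL (trans (iterN-suc (pair x r) i) (cong (λ z → iterN z i) (pR-pair x r)))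

entry⇒∈ : ∀ xs y i → i < length xs → entry (entries xs) i ≡ y → y ∈ xs
entry⇒∈ (x ∷ xs) y zero    lt       q = here (trans (sym q) (pL-pair x (entries xs)))
entry⇒∈ (x ∷ xs) y (suc i) (s≤s lt) q = there (entry⇒∈ xs y i lt (trans (sym (entry-suc x (entries xs) i)) q))

∈⇒entry : ∀ xs y → y ∈ xs → ∃[ i ] (i < length xs × entry (entries xs) i ≡ y)
∈⇒entry (x ∷ xs) y (here refl) = 0 , s≤s z≤n , pL-pair x (entries xs)
∈⇒entry (x ∷ xs) y (there p) with ∈⇒entry xs y p
... | i , lt , q = suc i , s≤s lt , trans (entry-suc x (entries xs) i) q

Listed⇒∈ : ∀ xs y → Listed (encList xs) y → y ∈ xs
Listed⇒∈ xs y (i , lt , q) = entry⇒∈ xs y i (subst (i <_) (pL-pair (length xs) (entries xs)) lt)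
  (trans (cong (λ z → entry z i) (sym (pR-pair (length xs) (entries xs)))) q)

∈⇒Listed : ∀ xs y → y ∈ xs → Listed (encList xs) y
∈⇒Listed xs y p with ∈⇒entry xs y p
... | i , lt , q = i , subst (i <_) (sym (pL-pair (length xs) (entries xs))) lt ,
                   trans (cong (λ z → entry z i) (pR-pair (length xs) (entries xs))) q

data ValidList : List ℕ → Set where
  vnil  : ValidList []
  vcons : ∀ {x xs} → ruleN (jFun x) (jArg x) (jVal x) (encList xs) ≡ 0 → ValidList xs → ValidList (x ∷ xs)

allN-suc : ∀ b f → f 0 ≡ 0 → allN b (λ i → f (suc i)) ≡ 0 → allN (suc b) f ≡ 0
allN-suc b f h₀ h = allN-intro (suc b) f below
  where
  below : ∀ i → i < suc b → f i ≡ 0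
  below zero    _        = h₀
  below (suc i) (s≤s lt) = allN-elim b _ h i lt

entryCheckN : ℕ → ℕ → ℕ → ℕ
entryCheckN len raw i = let x = entry raw i in ruleN (jFun x) (jArg x) (jVal x) (pair (len ∸ suc i) (iterN raw (suc i)))

entryCheckN-suc : ∀ len raw i → entryCheckN (suc len) raw (suc i) ≡ entryCheckN len (pR raw) i
entryCheckN-suc len raw i rewrite iterN-suc raw i = refl

entryCheckN-zero : ∀ len x r → entryCheckN (suc len) (pair x r) 0 ≡ ruleN (jFun x) (jArg x) (jVal x) (pair len r)
entryCheckN-zero len x r rewrite pL-pair x r | pR-pair x r = refl

ValidList⇒validEntriesN : ∀ xs → ValidList xs → validEntriesN (length xs) (entries xs) ≡ 0
ValidList⇒validEntriesN [] vnil = refl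
ValidList⇒validEntriesN (x ∷ xs) (vcons h v) =
  allN-suc (length xs) (entryCheckN (suc (length xs)) raw) (trans (entryCheckN-zero (length xs) x (entries xs)) h)
    (trans (recN-cong refl (λ i r → cong (r +_) (shift i)) (length xs)) (ValidList⇒validEntriesN xs v))
  where
  raw = pair x (entries xs)
  shift : ∀ i → entryCheckN (suc (length xs)) raw (suc i) ≡ entryCheckN (length xs) (entries xs) i
  shift i = trans (entryCheckN-suc (length xs) raw i) (cong (λ r → entryCheckN (length xs) r i) (pR-pair x (entries xs)))

validN-encList : ∀ xs → validN (encList xs) ≡ validEntriesN (length xs) (entries xs)
validN-encList xs = cong₂ validEntriesN (pL-pair (length xs) (entries xs)) (pR-pair (length xs) (entries xs))

ruleN-++ : ∀ x xs ys → ruleN (jFun x) (jArg x) (jVal x) (encList xs) ≡ 0 → ruleN (jFun x) (jArg x) (jVal x) (encList (xs ++ ys)) ≡ 0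
ruleN-++ x xs ys h = ruleN-encode (jFun x) (jArg x) (jVal x) (encList (xs ++ ys))
  (Rule-mono (λ y p → ∈⇒Listed (xs ++ ys) y (∈-++⁺ˡ (Listed⇒∈ xs y p))) (ruleN-decode (jFun x) (jArg x) (jVal x) (encList xs) h))

ValidList-++ : ∀ xs ys → ValidList xs → ValidList ys → ValidList (xs ++ ys)
ValidList-++ []       ys vnil        w = w
ValidList-++ (x ∷ xs) ys (vcons h v) w = vcons (ruleN-++ x xs ys h) (ValidList-++ xs ys v w)

ValidList-rule : ∀ e n m xs → Rule (Listed (encList xs)) e n m → ValidList xs → ValidList (judgement e n m ∷ xs)
ValidList-rule e n m xs r = vcons
  (subst₂ (λ a b → ruleN a b (jVal (judgement e n m)) (encList xs) ≡ 0) (sym (jFun-judgement e n m)) (sym (jArg-judgement e n m))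
    (subst (λ c → ruleN e n c (encList xs) ≡ 0) (sym (jVal-judgement e n m)) (ruleN-encode e n m (encList xs) r)))

CertList : ℕ → ℕ → ℕ → Set
CertList e n m = ∃[ xs ] ValidList (judgement e n m ∷ xs)

CertList-merge : ∀ {a b c a′ b′ c′} → CertList a b c → CertList a′ b′ c′ →
                 ∃[ L ] (ValidList L × judgement a b c ∈ L × judgement a′ b′ c′ ∈ L)
CertList-merge {a} {b} {c} {a′} {b′} {c′} (xs , v) (ys , w) =
  J ∷ xs ++ J′ ∷ ys , ValidList-++ (J ∷ xs) (J′ ∷ ys) v w , ∈-++⁺ˡ {ys = J′ ∷ ys} (here refl) , ∈-++⁺ʳ (J ∷ xs) (here refl)
  where
  J  = judgement a b c
  J′ = judgement a′ b′ c′

CertList-gather : ∀ f n k → (∀ z → z < k → ∃[ w ] CertList f (pair n z) (suc w)) →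
                  ∃[ L ] (ValidList L × (∀ z → z < k → ∃[ w ] (judgement f (pair n z) (suc w) ∈ L)))
CertList-gather f n zero    G = [] , vnil , λ _ ()
CertList-gather f n (suc k) G with G k ≤-refl | CertList-gather f n k (λ z z<k → G z (m<n⇒m<1+n z<k))
... | w , xs , v | L , vL , listed = J ∷ xs ++ L , ValidList-++ (J ∷ xs) L v vL , listed′
  where
  J = judgement f (pair n k) (suc w)
  listed′ : ∀ z → z < suc k → ∃[ w′ ] (judgement f (pair n z) (suc w′) ∈ J ∷ xs ++ L)
  listed′ z (s≤s z≤k) with m≤n⇒m<n∨m≡n z≤k
  ... | inj₁ z<k = let w′ , p = listed z z<k in w′ , ∈-++⁺ʳ (J ∷ xs) p
  ... | inj₂ refl = w , here refl

certList : ∀ {e n m} → e · n ≃ m → CertList e n m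
certList {e} {n} (ap-zero t)  = [] , ValidList-rule e n 0 [] (rule-zero t refl) vnil
certList {e} {n} (ap-succ t)  = [] , ValidList-rule e n (suc n) [] (rule-succ t refl) vnil
certList {e} {n} (ap-id t)    = [] , ValidList-rule e n n [] (rule-id t refl) vnil
certList {e} {n} (ap-left t)  = [] , ValidList-rule e n (pL n) [] (rule-left t refl) vnil
certList {e} {n} (ap-right t) = [] , ValidList-rule e n (pR n) [] (rule-right t refl) vnil
certList {e} {n} {m} (ap-comp {m = k} t d₁ d₂) =
  let L , v , p , q = CertList-merge (certList d₁) (certList d₂)
  in L , ValidList-rule e n m L (rule-comp t k (∈⇒Listed L _ p) (∈⇒Listed L _ q)) v
certList {e} {n} (ap-pair {a = a} {b = b} t d₁ d₂) =
  let L , v , p , q = CertList-merge (certList d₁) (certList d₂)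
  in L , ValidList-rule e n (pair a b) L (rule-pair t a b (∈⇒Listed L _ p) (∈⇒Listed L _ q) refl) v
certList {e} {n} {m} (ap-rec0 t z d) =
  let xs , v = certList d
      J = judgement (pL (pR e)) (pL n) m
  in J ∷ xs , ValidList-rule e n m (J ∷ xs) (rule-rec0 t z (∈⇒Listed (J ∷ xs) J (here refl))) v
certList {e} {n} {m} (ap-recS {y = y} {r = r} t s d₁ d₂) =
  let L , v , p , q = CertList-merge (certList d₁) (certList d₂)
  in L , ValidList-rule e n m L (rule-recS t y r s (∈⇒Listed L _ p) (∈⇒Listed L _ q)) v
certList {e} {n} (ap-min {y = y} t d F) =
  let xs , v = certList d
      L , vL , listed = CertList-gather (pR e) n y (λ z lt → proj₁ (F z lt) , certList (proj₂ (F z lt)))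
      J = judgement (pR e) (pair n y) 0
      L′ = J ∷ xs ++ L
  in L′ , ValidList-rule e n y L′ (rule-min t (∈⇒Listed L′ J (here refl))
            (λ z lt → let w , p = listed z lt in w , ∈⇒Listed L′ _ (∈-++⁺ʳ (J ∷ xs) p))) (ValidList-++ (J ∷ xs) L v vL)

validEntriesN-sound : ∀ len raw → validEntriesN len raw ≡ 0 → ∀ i → i < len → Holds (entry raw i)
validEntriesN-sound (suc len) raw h = holds
  where
  valid-rest : validEntriesN len (pR raw) ≡ 0
  valid-rest = allN-intro len _ λ i lt →
    trans (sym (entryCheckN-suc len raw i)) (allN-elim (suc len) (entryCheckN (suc len) raw) h (suc i) (s≤s lt))
  holds-rest = validEntriesN-sound len (pR raw) valid-rest
  holds-listed : ∀ y → Listed (pair len (pR raw)) y → Holds y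
  holds-listed y (i , lt , q) = subst Holds (trans (cong (λ z → entry z i) (sym (pR-pair len (pR raw)))) q)
                                  (holds-rest i (subst (i <_) (pL-pair len (pR raw)) lt))
  holds : ∀ i → i < suc len → Holds (entry raw i)
  holds zero    _        = Rule-sound (ruleN-decode _ _ _ (pair len (pR raw))
                             (allN-elim (suc len) (entryCheckN (suc len) raw) h 0 (s≤s z≤n))) holds-listed
  holds (suc i) (s≤s lt) = subst Holds (sym (cong pL (iterN-suc raw i))) (holds-rest i lt)

-- 1 ∸ pL t ≡ 0 says that the list coded by t is nonempty, and pL (pR t) is its first entry.
Certifies : ℕ → ℕ → Set
Certifies t J = validN t ≡ 0 × 1 ∸ pL t ≡ 0 × pL (pR t) ≡ J

certificate : ∀ {f a v} → f · a ≃ v → ∃[ t ] Certifies t (judgement f a v)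
certificate {f} {a} {v} d = encList (J ∷ xs) ,
  trans (validN-encList (J ∷ xs)) (ValidList⇒validEntriesN (J ∷ xs) valid) ,
  trans (cong (1 ∸_) (pL-pair (length (J ∷ xs)) (entries (J ∷ xs)))) (0∸n≡0 (length xs)) ,
  trans (cong pL (pR-pair (length (J ∷ xs)) (entries (J ∷ xs)))) (pL-pair J (entries xs))
  where
  J = judgement f a v
  xs = proj₁ (certList d)
  valid = proj₂ (certList d)

certificate-sound : ∀ t {f a v} → Certifies t (judgement f a v) → f · a ≃ v
certificate-sound t (valid , nonempty , first) with 1∸n≡0⇒n≡suc nonempty
... | _ , len≡suc = Holds-judgement (subst Holds first
                      (validEntriesN-sound (pL t) (pR t) valid 0 (subst (0 <_) (sym len≡suc) (s≤s z≤n))))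

certifiesN : ℕ → ℕ → ℕ
certifiesN t x = let J = pL (pR t) in andN (validN t) (andN (1 ∸ pL t) (andN (eqN (jFun J) (pL x)) (eqN (jArg J) (pR x))))

opaque
  unfolding judgement

  evE-validE : ∀ (ρ : Env 1) → evE validE ρ ≡ validN (ρ zero)
  evE-validE ρ = refl

  judgement-def : ∀ a b c → judgement a b c ≡ pair a (pair b c)
  judgement-def a b c = refl

certifiesE : ETerm 2
certifiesE = andE (sbE (var (# 0) ∷ []) validE) (andE (subtE (lit 1) (lE (var (# 0))))
  (andE (eqE (jFunE (lE (rE (var (# 0))))) (lE (var (# 1)))) (eqE (jArgE (lE (rE (var (# 0))))) (rE (var (# 1))))))

evE-certifiesE : ∀ t x → evE certifiesE (t ∷ρ (x ∷ρ ρ₀)) ≡ certifiesN t x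
evE-certifiesE t x = cong (λ c → andN c (andN (1 ∸ pL t) (andN (eqN (jFun J) (pL x)) (eqN (jArg J) (pR x)))))
                           (evE-validE (evEV (var (# 0) ∷ []) (t ∷ρ (x ∷ρ ρ₀))))
  where
  J = pL (pR t)

certificate-certifiesN : ∀ {f a v} → f · a ≃ v → ∃[ t ] (certifiesN t (pair f a) ≡ 0)
certificate-certifiesN {f} {a} {v} d with certificate d
... | t , valid , nonempty , first = t , andN-intro valid (andN-intro nonempty (andN-intro
      (≡⇒eqN≡0 (trans (cong jFun first) (trans (jFun-judgement f a v) (sym (pL-pair f a)))))
      (≡⇒eqN≡0 (trans (cong jArg first) (trans (jArg-judgement f a v) (sym (pR-pair f a)))))))

certifiesN-sound : ∀ t f a → certifiesN t (pair f a) ≡ 0 → f · a ≃ jVal (pL (pR t))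
certifiesN-sound t f a h = certificate-sound t (andN-proj₁ h , andN-proj₁ (andN-proj₂ h) , first)
  where
  J = pL (pR t)
  fun : jFun J ≡ f
  fun = trans (eqN≡0⇒≡ _ _ (andN-proj₁ (andN-proj₂ (andN-proj₂ h)))) (pL-pair f a)
  arg : jArg J ≡ a
  arg = trans (eqN≡0⇒≡ _ _ (andN-proj₂ (andN-proj₂ (andN-proj₂ h)))) (pR-pair f a)
  first : J ≡ judgement f a (jVal J)
  first = trans (sym (judgement-η J)) (cong₂ (λ f′ a′ → judgement f′ a′ (jVal J)) fun arg)

cSwap cOut cUniversal : ℕ
cSwap = cPair cRight (cPair cLeft cZero)
cOut = cComp cRight (cComp cRight (cComp cLeft cRight))
-- Search for the least certificate t of a judgement f · a ≃ v, and read v off its first entry.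
cUniversal = cComp cOut (cMin (cComp (cE certifiesE) cSwap))

cSwap-· : ∀ x t → cSwap · pair x t ≃ encEnv (t ∷ρ (x ∷ρ ρ₀))
cSwap-· x t = cPair-· (≃-respʳ (pR-pair x t) cRight-·) (cPair-· (≃-respʳ (pL-pair x t) cLeft-·) cZero-·)

cCertifies-· : ∀ x t → cComp (cE certifiesE) cSwap · pair x t ≃ certifiesN t x
cCertifies-· x t = cComp-· (cSwap-· x t) (≃-respʳ (evE-certifiesE t x) (cE-· certifiesE (t ∷ρ (x ∷ρ ρ₀))))

cOut-· : ∀ t → cOut · t ≃ jVal (pL (pR t))
cOut-· t = cComp-· (cComp-· (cComp-· cRight-· cLeft-·) cRight-·) cRight-·

cUniversal-· : ∀ {f a v} → f · a ≃ v → cUniversal · pair f a ≃ v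
cUniversal-· {f} {a} {v} d with certificate-certifiesN d
... | t , ht with least-zero (λ t → certifiesN t (pair f a)) t ht
...   | y , hy , below = cComp-·
  (cMin-· (≃-respʳ hy (cCertifies-· (pair f a) y))
          (λ z lt → proj₁ (below z lt) , ≃-respʳ (proj₂ (below z lt)) (cCertifies-· (pair f a) z)))
  (≃-respʳ (·-functional (certifiesN-sound y f a hy) d) (cOut-· y))

cConst : ℕ → ℕ
cConst zero = cZero
cConst (suc k) = cComp cSuc (cConst k)

cConst-· : ∀ k {n} → cConst k · n ≃ k
cConst-· zero = cZero-·
cConst-· (suc k) = cComp-· (cConst-· k) cSuc-·

closure : ℕ → ℕ → ℕ
closure c e = cComp c (cPair cId (cConst e))

closure-· : ∀ {c e a r} → c · pair a e ≃ r → closure c e · a ≃ r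
closure-· {c} {e} d = cComp-· (cPair-· cId-· (cConst-· e)) d

closureE : ∀ {n} → ETerm n → ETerm n → ETerm n
closureE c e = pE (lit 5) (pE c (pE (lit 6) (pE (lit cId) (recE e (lit cZero) (pE (lit 5) (pE (lit cSuc) (var zero)))))))

evE-closureE : ∀ {n} (c e : ETerm n) (ρ : Env n) → evE (closureE c e) ρ ≡ closure (evE c ρ) (evE e ρ)
evE-closureE c e ρ = trans (cong (λ z → pair 5 (pair (evE c ρ) (pair 6 (pair cId z)))) (recN-cConst (evE e ρ)))
  (sym (trans (cComp-def (evE c ρ) _) (cong (λ z → pair 5 (pair (evE c ρ) z)) (cPair-def cId (cConst (evE e ρ))))))
  where
  recN-cConst : ∀ k → recN cZero (λ y r → pair 5 (pair cSuc r)) k ≡ cConst k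
  recN-cConst zero    = refl
  recN-cConst (suc k) = trans (cong (λ z → pair 5 (pair cSuc z)) (recN-cConst k)) (sym (cComp-def cSuc (cConst k)))

-- Programs may apply computed indices (through cUniversal) and search without bound, so their
-- semantics evP is a relation.
data Prog : ℕ → Set where
  expr : ∀ {n} → ETerm n → Prog n
  pairP appP : ∀ {n} → Prog n → Prog n → Prog n
  letP : ∀ {n} → Prog n → Prog (suc n) → Prog n
  muP lamP : ∀ {n} → Prog (suc n) → Prog n

cP : ∀ {n} → Prog n → ℕ
cP (expr e) = cE e
cP (pairP a b) = cPair (cP a) (cP b)
cP (appP f a) = cComp cUniversal (cPair (cP f) (cP a))
cP (letP a b) = cComp (cP b) (cPair (cP a) cId)
cP (muP b) = cMin (cComp (cP b) (cPair cRight cLeft))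
cP (lamP b) = cComp (cE (closureE {1} (lit (cP b)) (var zero))) (cPair cId cZero)

evP : ∀ {n} → Prog n → Env n → ℕ → Set
evP (expr e) ρ v = evE e ρ ≡ v
evP (pairP a b) ρ v = ∃[ x ] ∃[ y ] (evP a ρ x × evP b ρ y × v ≡ pair x y)
evP (appP f a) ρ v = ∃[ x ] ∃[ y ] (evP f ρ x × evP a ρ y × x · y ≃ v)
evP (letP a b) ρ v = ∃[ x ] (evP a ρ x × evP b (x ∷ρ ρ) v)
evP (muP b) ρ v = evP b (v ∷ρ ρ) 0 × (∀ z → z < v → ∃[ w ] evP b (z ∷ρ ρ) (suc w))
evP (lamP b) ρ v = v ≡ closure (cP b) (encEnv ρ)

cP-· : ∀ {n} (p : Prog n) (ρ : Env n) {v} → evP p ρ v → cP p · encEnv ρ ≃ v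
cP-· (expr e) ρ refl = cE-· e ρ
cP-· (pairP a b) ρ (x , y , ha , hb , refl) = cPair-· (cP-· a ρ ha) (cP-· b ρ hb)
cP-· (appP f a) ρ (x , y , hf , ha , d) = cComp-· (cPair-· (cP-· f ρ hf) (cP-· a ρ ha)) (cUniversal-· d)
cP-· (letP a b) ρ (x , ha , hb) = cComp-· (cPair-· (cP-· a ρ ha) cId-·) (cP-· b (x ∷ρ ρ) hb)
cP-· (muP b) ρ {v} (h0 , hs) = cMin-· (cComp-· swap-· (cP-· b (v ∷ρ ρ) h0))
  (λ z lt → proj₁ (hs z lt) , cComp-· swap-· (cP-· b (z ∷ρ ρ) (proj₂ (hs z lt))))
  where
  swap-· : ∀ {y} → cPair cRight cLeft · pair (encEnv ρ) y ≃ pair y (encEnv ρ)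
  swap-· {y} = cPair-· (≃-respʳ (pR-pair (encEnv ρ) y) cRight-·) (≃-respʳ (pL-pair (encEnv ρ) y) cLeft-·)
cP-· (lamP b) ρ refl = cComp-· (cPair-· cId-· cZero-·)
  (≃-respʳ (evE-closureE (lit (cP b)) (var zero) (encEnv ρ ∷ρ ρ₀)) (cE-· (closureE (lit (cP b)) (var zero)) (encEnv ρ ∷ρ ρ₀)))

closure-cP-· : ∀ {n} (b : Prog (suc n)) (ρ : Env n) {a r} → evP b (a ∷ρ ρ) r → closure (cP b) (encEnv ρ) · a ≃ r
closure-cP-· b ρ {a} h = closure-· (cP-· b (a ∷ρ ρ) h)

⟦⟧-ext : ∀ {n} (t : Tm n) {ρ ρ′ : Env n} → (∀ i → ρ i ≡ ρ′ i) → ⟦ t ⟧ ρ ≡ ⟦ t ⟧ ρ′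
⟦⟧-ext (var i)     h = h i
⟦⟧-ext zer         h = refl
⟦⟧-ext (sucT t)    h = cong suc (⟦⟧-ext t h)
⟦⟧-ext (t +T s)    h = cong₂ _+_ (⟦⟧-ext t h) (⟦⟧-ext s h)
⟦⟧-ext (t *T s)    h = cong₂ _*_ (⟦⟧-ext t h) (⟦⟧-ext s h)
⟦⟧-ext (pairT t s) h = cong₂ pair (⟦⟧-ext t h) (⟦⟧-ext s h)
⟦⟧-ext (lft t)     h = cong pL (⟦⟧-ext t h)
⟦⟧-ext (rgt t)     h = cong pR (⟦⟧-ext t h)
⟦⟧-ext (xiT t s)   h = cong₂ Xi (⟦⟧-ext t h) (⟦⟧-ext s h)

⟦renT⟧ : ∀ {n m} (r : Fin n → Fin m) (t : Tm n) (ρ : Env m) → ⟦ renT r t ⟧ ρ ≡ ⟦ t ⟧ (λ i → ρ (r i))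
⟦renT⟧ r (var i)     ρ = refl
⟦renT⟧ r zer         ρ = refl
⟦renT⟧ r (sucT t)    ρ = cong suc (⟦renT⟧ r t ρ)
⟦renT⟧ r (t +T s)    ρ = cong₂ _+_ (⟦renT⟧ r t ρ) (⟦renT⟧ r s ρ)
⟦renT⟧ r (t *T s)    ρ = cong₂ _*_ (⟦renT⟧ r t ρ) (⟦renT⟧ r s ρ)
⟦renT⟧ r (pairT t s) ρ = cong₂ pair (⟦renT⟧ r t ρ) (⟦renT⟧ r s ρ)
⟦renT⟧ r (lft t)     ρ = cong pL (⟦renT⟧ r t ρ)
⟦renT⟧ r (rgt t)     ρ = cong pR (⟦renT⟧ r t ρ)
⟦renT⟧ r (xiT t s)   ρ = cong₂ Xi (⟦renT⟧ r t ρ) (⟦renT⟧ r s ρ)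

⟦subT⟧ : ∀ {n m} (σ : Fin n → Tm m) (t : Tm n) (ρ : Env m) → ⟦ subT σ t ⟧ ρ ≡ ⟦ t ⟧ (λ i → ⟦ σ i ⟧ ρ)
⟦subT⟧ σ (var i)     ρ = refl
⟦subT⟧ σ zer         ρ = refl
⟦subT⟧ σ (sucT t)    ρ = cong suc (⟦subT⟧ σ t ρ)
⟦subT⟧ σ (t +T s)    ρ = cong₂ _+_ (⟦subT⟧ σ t ρ) (⟦subT⟧ σ s ρ)
⟦subT⟧ σ (t *T s)    ρ = cong₂ _*_ (⟦subT⟧ σ t ρ) (⟦subT⟧ σ s ρ)
⟦subT⟧ σ (pairT t s) ρ = cong₂ pair (⟦subT⟧ σ t ρ) (⟦subT⟧ σ s ρ)
⟦subT⟧ σ (lft t)     ρ = cong pL (⟦subT⟧ σ t ρ)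
⟦subT⟧ σ (rgt t)     ρ = cong pR (⟦subT⟧ σ t ρ)
⟦subT⟧ σ (xiT t s)   ρ = cong₂ Xi (⟦subT⟧ σ t ρ) (⟦subT⟧ σ s ρ)

⟦wkT-wkT⟧ : ∀ {n} (t : Tm n) j k (ρ : Env n) → ⟦ wkT (wkT t) ⟧ (j ∷ρ (k ∷ρ ρ)) ≡ ⟦ t ⟧ ρ
⟦wkT-wkT⟧ t j k ρ = trans (⟦renT⟧ suc (wkT t) (j ∷ρ (k ∷ρ ρ))) (⟦renT⟧ suc t (k ∷ρ ρ))

evE-ext : ∀ {n} (e : ETerm n) {ρ ρ′ : Env n} → (∀ i → ρ i ≡ ρ′ i) → evE e ρ ≡ evE e ρ′
evEV-ext : ∀ {n m} (vs : Vec (ETerm n) m) {ρ ρ′ : Env n} → (∀ i → ρ i ≡ ρ′ i) → ∀ i → evEV vs ρ i ≡ evEV vs ρ′ i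
evE-ext (var i)     h = h i
evE-ext (lit k)     h = refl
evE-ext (sE e)      h = cong suc (evE-ext e h)
evE-ext (lE e)      h = cong pL (evE-ext e h)
evE-ext (rE e)      h = cong pR (evE-ext e h)
evE-ext (pE a b)    h = cong₂ pair (evE-ext a h) (evE-ext b h)
evE-ext (addE a b)  h = cong₂ _+_ (evE-ext a h) (evE-ext b h)
evE-ext (andE a b)  h = cong₂ andN (evE-ext a h) (evE-ext b h)
evE-ext (subtE a b) h = cong₂ _∸_ (evE-ext a h) (evE-ext b h)
evE-ext (mulE a b)  h = cong₂ _*_ (evE-ext a h) (evE-ext b h)
evE-ext (eqE a b)   h = cong₂ eqN (evE-ext a h) (evE-ext b h)
evE-ext (iterE a b) h = cong₂ iterN (evE-ext a h) (evE-ext b h)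
evE-ext (selE c a b) {ρ} {ρ′} h =
  trans (cong₂ (λ x y → selN x y (evE b ρ)) (evE-ext c h) (evE-ext a h)) (cong (selN (evE c ρ′) (evE a ρ′)) (evE-ext b h))
evE-ext (allE bd body) {ρ} {ρ′} h = trans (cong (λ z → allN z _) (evE-ext bd h))
  (recN-cong refl (λ y r → cong (r +_) (evE-ext body (∷ρ-ext y h))) (evE bd ρ′))
evE-ext (exE bd body) {ρ} {ρ′} h = trans (cong (λ z → exN z _) (evE-ext bd h))
  (recN-cong refl (λ y r → cong (r *_) (evE-ext body (∷ρ-ext y h))) (evE bd ρ′))
evE-ext (muE bd body) {ρ} {ρ′} h = trans (cong (λ z → muN z _) (evE-ext bd h))
  (recN-cong refl (λ y r → cong (λ z → selN (eqN r y) (selN z y (suc y)) r) (evE-ext body (∷ρ-ext y h))) (evE bd ρ′))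
evE-ext (recE bd b s) {ρ} {ρ′} h = trans (cong (recN (evE b ρ) (λ y r → evE s (r ∷ρ (y ∷ρ ρ)))) (evE-ext bd h))
  (recN-cong (evE-ext b h) (λ y r → evE-ext s (∷ρ-ext r (∷ρ-ext y h))) (evE bd ρ′))
evE-ext (sbE vs e) h = evE-ext e (evEV-ext vs h)
evEV-ext (x ∷ xs) h zero    = evE-ext x h
evEV-ext (x ∷ xs) h (suc i) = evEV-ext xs h i

evEV-tabulate : ∀ {n m} (f : Fin m → ETerm n) (ρ : Env n) (i : Fin m) → evEV (tabulate f) ρ i ≡ evE (f i) ρ
evEV-tabulate f ρ zero    = refl
evEV-tabulate f ρ (suc i) = evEV-tabulate (λ j → f (suc j)) ρ i

shiftV : ∀ {n} → Vec (ETerm (suc n)) n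
shiftV = tabulate (λ i → var (suc i))

evEV-shiftV : ∀ {n} (w : ℕ) (ρ : Env n) i → evEV shiftV (w ∷ρ ρ) i ≡ ρ i
evEV-shiftV w ρ = evEV-tabulate (λ i → var (suc i)) (w ∷ρ ρ)

wkE : ∀ {n} → ETerm n → ETerm (suc n)
wkE e = sbE shiftV e

evE-wkE : ∀ {n} (e : ETerm n) (w : ℕ) (ρ : Env n) → evE (wkE e) (w ∷ρ ρ) ≡ evE e ρ
evE-wkE e w ρ = evE-ext e (evEV-shiftV w ρ)

substE : ∀ {n} → ETerm n → ETerm (suc n) → ETerm n
substE x e = sbE (x ∷ tabulate var) e

evE-substE : ∀ {n} (x : ETerm n) (e : ETerm (suc n)) (ρ : Env n) → evE (substE x e) ρ ≡ evE e (evE x ρ ∷ρ ρ)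
evE-substE x e ρ = evE-ext e λ { zero → refl ; (suc i) → evEV-tabulate var ρ i }

replace0E : ∀ {n} → ETerm (suc n) → ETerm (suc n) → ETerm (suc n)
replace0E x e = sbE (x ∷ shiftV) e

evE-replace0E : ∀ {n} (x e : ETerm (suc n)) (w : ℕ) (ρ : Env n) →
                evE (replace0E x e) (w ∷ρ ρ) ≡ evE e (evE x (w ∷ρ ρ) ∷ρ ρ)
evE-replace0E x e w ρ = evE-ext e λ { zero → refl ; (suc i) → evEV-shiftV w ρ i }

split0E : ∀ {n} → ETerm (suc n) → ETerm (suc n) → ETerm (suc (suc n)) → ETerm (suc n)
split0E x y e = sbE (y ∷ x ∷ shiftV) e

evE-split0E : ∀ {n} (x y : ETerm (suc n)) (e : ETerm (suc (suc n))) (w : ℕ) (ρ : Env n) →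
              evE (split0E x y e) (w ∷ρ ρ) ≡ evE e (evE y (w ∷ρ ρ) ∷ρ (evE x (w ∷ρ ρ) ∷ρ ρ))
evE-split0E x y e w ρ = evE-ext e λ { zero → refl ; (suc zero) → refl ; (suc (suc i)) → evEV-shiftV w ρ i }

envAtE : ∀ {m} n → (Fin n → Fin m) → ETerm m
envAtE zero    r = lit 0
envAtE (suc n) r = pE (var (r zero)) (envAtE n (λ i → r (suc i)))

evE-envAtE : ∀ {m} n (r : Fin n → Fin m) (ρ : Env m) → evE (envAtE n r) ρ ≡ encEnv (λ i → ρ (r i))
evE-envAtE zero    r ρ = refl
evE-envAtE (suc n) r ρ = cong (pair (ρ (r zero))) (evE-envAtE n (λ i → r (suc i)) ρ)

envE : ∀ {n} → ETerm n
envE {n} = envAtE n (λ i → i)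

evE-envE : ∀ {n} (ρ : Env n) → evE envE ρ ≡ encEnv ρ
evE-envE {n} ρ = evE-envAtE n (λ i → i) ρ

closeE : ∀ {n} → ℕ → ETerm n
closeE c = closureE (lit c) envE

evE-closeE : ∀ {n} c (ρ : Env n) → evE (closeE c) ρ ≡ closure c (encEnv ρ)
evE-closeE c ρ = trans (evE-closureE (lit c) envE ρ) (cong (closure c) (evE-envE ρ))

closeE-· : ∀ {n} c (ρ : Env n) {a v} → c · pair a (encEnv ρ) ≃ v → evE (closeE c) ρ · a ≃ v
closeE-· c ρ d = ≃-respˡ (sym (evE-closeE c ρ)) (closure-· d)

constClosure-· : ∀ {c x v} a → c · x ≃ v → closure (cComp c cRight) x · a ≃ v
constClosure-· {x = x} a d = closure-· (cComp-· (≃-respʳ (pR-pair a x) cRight-·) d)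

termE : ∀ {n} → Tm n → ETerm n
termE (var i)     = var i
termE zer         = lit 0
termE (sucT t)    = sE (termE t)
termE (t +T s)    = addE (termE t) (termE s)
termE (t *T s)    = mulE (termE t) (termE s)
termE (pairT t s) = pE (termE t) (termE s)
termE (lft t)     = lE (termE t)
termE (rgt t)     = rE (termE t)
termE (xiT t s)   = sE (mulE (lit 2) (pE (termE t) (termE s)))

evE-termE : ∀ {n} (t : Tm n) (ρ : Env n) → evE (termE t) ρ ≡ ⟦ t ⟧ ρ
evE-termE (var i)     ρ = refl
evE-termE zer         ρ = refl
evE-termE (sucT t)    ρ = cong suc (evE-termE t ρ)
evE-termE (t +T s)    ρ = cong₂ _+_ (evE-termE t ρ) (evE-termE s ρ)
evE-termE (t *T s)    ρ = cong₂ _*_ (evE-termE t ρ) (evE-termE s ρ)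
evE-termE (pairT t s) ρ = cong₂ pair (evE-termE t ρ) (evE-termE s ρ)
evE-termE (lft t)     ρ = cong pL (evE-termE t ρ)
evE-termE (rgt t)     ρ = cong pR (evE-termE t ρ)
evE-termE (xiT t s)   ρ = cong (λ z → suc (2 * z)) (cong₂ pair (evE-termE t ρ) (evE-termE s ρ))

⟦renT⟧-at : ∀ {n m} (r : Fin n → Fin m) (t : Tm n) {ρ : Env m} {ρ′ : Env n} →
            (∀ i → ρ (r i) ≡ ρ′ i) → ⟦ renT r t ⟧ ρ ≡ ⟦ t ⟧ ρ′
⟦renT⟧-at r t h = trans (⟦renT⟧ r t _) (⟦⟧-ext t h)

⟦subT⟧-at : ∀ {n m} (σ : Fin n → Tm m) (t : Tm n) {ρ : Env m} {ρ′ : Env n} →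
            (∀ i → ⟦ σ i ⟧ ρ ≡ ρ′ i) → ⟦ subT σ t ⟧ ρ ≡ ⟦ t ⟧ ρ′
⟦subT⟧-at σ t h = trans (⟦subT⟧ σ t _) (⟦⟧-ext t h)

extR-∷ρ : ∀ {n m} {r : Fin n → Fin m} {ρ : Env m} {ρ′ : Env n} →
          (∀ i → ρ (r i) ≡ ρ′ i) → ∀ k i → (k ∷ρ ρ) (extR r i) ≡ (k ∷ρ ρ′) i
extR-∷ρ h k zero    = refl
extR-∷ρ h k (suc i) = h i

extS-∷ρ : ∀ {n m} {σ : Fin n → Tm m} {ρ : Env m} {ρ′ : Env n} →
          (∀ i → ⟦ σ i ⟧ ρ ≡ ρ′ i) → ∀ k i → ⟦ extS σ i ⟧ (k ∷ρ ρ) ≡ (k ∷ρ ρ′) i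
extS-∷ρ h k zero = refl
extS-∷ρ {σ = σ} {ρ} h k (suc i) = trans (⟦renT⟧ suc (σ i) (k ∷ρ ρ)) (h i)

∀-⇔ : {A : Set} {P Q : A → Set} → (∀ x → P x ⇔ Q x) → (∀ x → P x) ⇔ (∀ x → Q x)
∀-⇔ h = mk⇔ (λ f x → Equivalence.to (h x) (f x)) (λ f x → Equivalence.from (h x) (f x))

∃-⇔ : {A : Set} {P Q : A → Set} → (∀ x → P x ⇔ Q x) → (∃[ x ] P x) ⇔ (∃[ x ] Q x)
∃-⇔ h = mk⇔ (λ (x , p) → x , Equivalence.to (h x) p) (λ (x , q) → x , Equivalence.from (h x) q)

≡-⇔ : ∀ {a a′ b b′ : ℕ} → a ≡ a′ → b ≡ b′ → (a ≡ b) ⇔ (a′ ≡ b′)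
≡-⇔ refl refl = ⇔-id _

·≃-⇔ : ∀ {a a′ b b′ c c′} → a ≡ a′ → b ≡ b′ → c ≡ c′ → (a · b ≃ c) ⇔ (a′ · b′ ≃ c′)
·≃-⇔ refl refl refl = ⇔-id _

subst-⇔ : (P : ℕ → Set) {a a′ : ℕ} → a ≡ a′ → P a ⇔ P a′
subst-⇔ P refl = ⇔-id _

module Realisability (V M T : ℕ → Set) where
  open Realise V M T public

  ⊩-renF : ∀ {n m} (r : Fin n → Fin m) (A : Fm n) {ρ : Env m} {ρ′ : Env n} →
           (∀ i → ρ (r i) ≡ ρ′ i) → ∀ e → (e ⊩ renF r A [ ρ ]) ⇔ (e ⊩ A [ ρ′ ])
  ⊩-renF r (t ≐ s)     h e = ≡-⇔ (⟦renT⟧-at r t h) (⟦renT⟧-at r s h)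
  ⊩-renF r (app t s u) h e = ·≃-⇔ (⟦renT⟧-at r t h) (⟦renT⟧-at r s h) (⟦renT⟧-at r u h)
  ⊩-renF r (Vf t)      h e = subst-⇔ V (⟦renT⟧-at r t h)
  ⊩-renF r (Mf t)      h e = subst-⇔ M (⟦renT⟧-at r t h)
  ⊩-renF r (Tf t)      h e = subst-⇔ T (⟦renT⟧-at r t h)
  ⊩-renF r ⊥f          h e = ⇔-id _
  ⊩-renF r (A ∧f B)    h e = ⊩-renF r A h (pL e) ×-⇔ ⊩-renF r B h (pR e)
  ⊩-renF r (A ∨f B)    h e = (⇔-id _ ×-⇔ ⊩-renF r A h (pR e)) ⊎-⇔ (⇔-id _ ×-⇔ ⊩-renF r B h (pR e))
  ⊩-renF r (A ⇒ B)     h e = ∀-⇔ λ a → →-cong-⇔ (⊩-renF r A h a) (∃-⇔ λ b → ⇔-id _ ×-⇔ ⊩-renF r B h b)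
  ⊩-renF r (∀f A)      h e = ∀-⇔ λ k → ∃-⇔ λ b → ⇔-id _ ×-⇔ ⊩-renF (extR r) A (extR-∷ρ h k) b
  ⊩-renF r (∃f A)      h e = ⊩-renF (extR r) A (extR-∷ρ h (pL e)) (pR e)

  ⊩-subF : ∀ {n m} (σ : Fin n → Tm m) (A : Fm n) {ρ : Env m} {ρ′ : Env n} →
           (∀ i → ⟦ σ i ⟧ ρ ≡ ρ′ i) → ∀ e → (e ⊩ subF σ A [ ρ ]) ⇔ (e ⊩ A [ ρ′ ])
  ⊩-subF σ (t ≐ s)     h e = ≡-⇔ (⟦subT⟧-at σ t h) (⟦subT⟧-at σ s h)
  ⊩-subF σ (app t s u) h e = ·≃-⇔ (⟦subT⟧-at σ t h) (⟦subT⟧-at σ s h) (⟦subT⟧-at σ u h)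
  ⊩-subF σ (Vf t)      h e = subst-⇔ V (⟦subT⟧-at σ t h)
  ⊩-subF σ (Mf t)      h e = subst-⇔ M (⟦subT⟧-at σ t h)
  ⊩-subF σ (Tf t)      h e = subst-⇔ T (⟦subT⟧-at σ t h)
  ⊩-subF σ ⊥f          h e = ⇔-id _
  ⊩-subF σ (A ∧f B)    h e = ⊩-subF σ A h (pL e) ×-⇔ ⊩-subF σ B h (pR e)
  ⊩-subF σ (A ∨f B)    h e = (⇔-id _ ×-⇔ ⊩-subF σ A h (pR e)) ⊎-⇔ (⇔-id _ ×-⇔ ⊩-subF σ B h (pR e))
  ⊩-subF σ (A ⇒ B)     h e = ∀-⇔ λ a → →-cong-⇔ (⊩-subF σ A h a) (∃-⇔ λ b → ⇔-id _ ×-⇔ ⊩-subF σ B h b)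
  ⊩-subF σ (∀f A)      h e = ∀-⇔ λ k → ∃-⇔ λ b → ⇔-id _ ×-⇔ ⊩-subF (extS σ) A (extS-∷ρ h k) b
  ⊩-subF σ (∃f A)      h e = ⊩-subF (extS σ) A (extS-∷ρ h (pL e)) (pR e)

  ∧-realises : ∀ {n} {A B : Fm n} {ρ a b} → a ⊩ A [ ρ ] → b ⊩ B [ ρ ] → pair a b ⊩ (A ∧f B) [ ρ ]
  ∧-realises {A = A} {B} {ρ} {a} {b} p q =
    subst (λ c → c ⊩ A [ ρ ]) (sym (pL-pair a b)) p , subst (λ c → c ⊩ B [ ρ ]) (sym (pR-pair a b)) q

  ∃-realises : ∀ {n} {A : Fm (suc n)} {ρ k a} → a ⊩ A [ k ∷ρ ρ ] → pair k a ⊩ ∃f A [ ρ ]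
  ∃-realises {A = A} {ρ} {k} {a} p = subst₂ (λ c x → c ⊩ A [ x ∷ρ ρ ]) (sym (pR-pair k a)) (sym (pL-pair k a)) p

  ∨-realises : ∀ {n} {A B : Fm n} {ρ} d a b → (d ≡ 0 → a ⊩ A [ ρ ]) → (d ≢ 0 → b ⊩ B [ ρ ]) →
               pair d (selN d a b) ⊩ (A ∨f B) [ ρ ]
  ∨-realises {A = A} {B} {ρ} zero a b ha hb = inj₁ (pL-pair 0 a , subst (λ c → c ⊩ A [ ρ ]) (sym (pR-pair 0 a)) (ha refl))
  ∨-realises {A = A} {B} {ρ} (suc d) a b ha hb =
    inj₂ ((λ q → 0≢1+n (trans (sym q) (pL-pair (suc d) b))) , subst (λ c → c ⊩ B [ ρ ]) (sym (pR-pair (suc d) b)) (hb (λ ())))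

  realised-by : ∀ {n} (A : Fm n) (p : Prog n) → (∀ ρ → ∃[ v ] (evP p ρ v × v ⊩ A [ ρ ])) → Realised A
  realised-by {zero}  A p h = let v , _ , r = h ρ₀ in v , r
  realised-by {suc n} A p h = realised-by (∀f A) (lamP p) λ ρ →
    closure (cP p) (encEnv ρ) , refl , λ k → let v , ev , r = h (k ∷ρ ρ) in v , closure-cP-· p ρ ev , r

-- V2f and ECTf are defined with local renamings, so their subformulas are read off the formulas themselves.

hyp concl ∧ˡ ∧ʳ : ∀ {k} → Fm k → Fm k
hyp (A ⇒ B) = A
hyp _       = ⊥f
concl (A ⇒ B) = B
concl _       = ⊥f
∧ˡ (A ∧f B) = A
∧ˡ _        = ⊥f
∧ʳ (A ∧f B) = B
∧ʳ _        = ⊥f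

∀-body ∃-body : ∀ {k} → Fm k → Fm (suc k)
∀-body (∀f A) = A
∀-body _      = ⊥f
∃-body (∃f A) = A
∃-body _      = ⊥f

zero-· : ∀ {n} → 0 · n ≃ 0
zero-· = ap-zero refl

module AxiomRealisers (V M T : ℕ → Set) where
  open Realisability V M T

  -- The atoms V, M, T are realised by anything, so the constant function 0 does for (V1) and (X2).

  V1-realised : V1-meta V M T → Realised V1f
  V1-realised V1 = 0 , λ x → 0 , zero-· , λ a ha → 0 , zero-· , V1 x λ n →
    let b , _ , x·n≃u , M-u , T⇒V = ha n in pL b , x·n≃u , M-u , λ T-u → proj₂ (proj₂ (T⇒V 0 T-u))

  X2-realised : X2-meta M T → Realised X2f
  X2-realised X2 = 0 , λ f → 0 , zero-· , λ g → 0 , zero-· , λ a (M-f , M-g) → 0 , zero-· , X2 f g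
    (λ n u f·n≃u → let _ , _ , r₁ = M-f n ; _ , _ , r₂ = r₁ u in proj₂ (proj₂ (r₂ 0 f·n≃u)))
    (λ n u v f·n≃u g·n≃v T-u → let _ , _ , r₁ = M-g n ; _ , _ , r₂ = r₁ u ; _ , _ , r₃ = r₂ v in
       proj₂ (proj₂ (r₃ 0 (f·n≃u , g·n≃v , T-u))))

  private
    -- λ f g a. ⟨λ a′ n p. ⟨g n, 0⟩, 0⟩; the inner body ⟨g n, 0⟩ lives in context p, n, a′, a, g, f.
    X1-prog₆ : Prog 6
    X1-prog₆ = pairP (appP (expr (var (# 4))) (expr (var (# 1)))) (expr (lit 0))
    X1-prog₄ : Prog 4
    X1-prog₄ = lamP (lamP X1-prog₆)
    X1-prog₃ : Prog 3
    X1-prog₃ = pairP (lamP X1-prog₄) (expr (lit 0))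
    X1-prog₁ : Prog 1
    X1-prog₁ = lamP (lamP X1-prog₃)

  module _ (X1 : X1-meta M T) (ε : Env 0) (f g a : ℕ) (M-Ξ : M (Xi f g)) where
    private
      ρ : Env 2
      ρ = g ∷ρ (f ∷ρ ε)
      TΞ : Fm 2
      TΞ = Tf (xiT (var (# 1)) (var (# 0)))
      Cond : Fm 2
      Cond = ∀f (∃f (app (var (# 3)) (var (# 1)) (var (# 0)) ∧f Tf (var (# 0)))
                 ⇒ ∃f (app (var (# 2)) (var (# 1)) (var (# 0)) ∧f Tf (var (# 0))))
      ρ₃ : Env 3
      ρ₃ = a ∷ρ ρ

    X1-forward : closure (cP X1-prog₄) (encEnv ρ₃) ⊩ (TΞ ⇒ Cond) [ ρ ]
    X1-forward a′ T-Ξ = closure (cP (lamP X1-prog₆)) (encEnv (a′ ∷ρ ρ₃)) , closure-cP-· X1-prog₄ ρ₃ refl , λ n →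
      closure (cP X1-prog₆) (encEnv (n ∷ρ (a′ ∷ρ ρ₃))) , closure-cP-· (lamP X1-prog₆) (a′ ∷ρ ρ₃) refl , λ p (f·n≃u , T-u) →
        let v , g·n≃v , T-v = proj₁ (X1 f g M-Ξ) T-Ξ n (pL p , f·n≃u , T-u) in
        pair v 0 , closure-cP-· X1-prog₆ (n ∷ρ (a′ ∷ρ ρ₃)) (v , 0 , (g , n , refl , refl , g·n≃v) , refl , refl) ,
        ∃-realises {A = app (var (# 2)) (var (# 1)) (var (# 0)) ∧f Tf (var (# 0))} {ρ = n ∷ρ ρ} {k = v} {a = 0} (g·n≃v , T-v)

    X1-backward : 0 ⊩ (Cond ⇒ TΞ) [ ρ ]
    X1-backward c realises-Cond = 0 , zero-· , proj₂ (X1 f g M-Ξ) λ n (u , f·n≃u , T-u) →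
      let _ , _ , r = realises-Cond n
          q , _ , g·n≃v , T-v = r (pair u 0) (∃-realises {A = app (var (# 3)) (var (# 1)) (var (# 0)) ∧f Tf (var (# 0))}
                                                         {ρ = n ∷ρ ρ} {k = u} {a = 0} (f·n≃u , T-u))
      in pL q , g·n≃v , T-v

    X1-both : pair (closure (cP X1-prog₄) (encEnv ρ₃)) 0 ⊩ ((TΞ ⇒ Cond) ∧f (Cond ⇒ TΞ)) [ ρ ]
    X1-both = ∧-realises {A = TΞ ⇒ Cond} {B = Cond ⇒ TΞ} {ρ = ρ} {a = closure (cP X1-prog₄) (encEnv ρ₃)} {b = 0}
                X1-forward X1-backward

  X1-realised : X1-meta M T → Realised X1f
  X1-realised X1 = realised-by X1f (lamP X1-prog₁) λ ρ → closure (cP X1-prog₁) (encEnv ρ) , refl , λ f →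
    closure (cP (lamP X1-prog₃)) (encEnv (f ∷ρ ρ)) , closure-cP-· X1-prog₁ ρ refl , λ g →
    closure (cP X1-prog₃) (encEnv (g ∷ρ (f ∷ρ ρ))) , closure-cP-· (lamP X1-prog₃) (f ∷ρ ρ) refl , λ a M-Ξ →
    pair (closure (cP X1-prog₄) (encEnv (a ∷ρ (g ∷ρ (f ∷ρ ρ))))) 0 ,
    closure-cP-· X1-prog₃ (g ∷ρ (f ∷ρ ρ)) (closure (cP X1-prog₄) (encEnv (a ∷ρ (g ∷ρ (f ∷ρ ρ)))) , 0 , refl , refl , refl) ,
    X1-both X1 ρ f g a M-Ξ

  -- From a realiser h of the premise, G h is an index of x ↦ g x, where g x · a runs h · x on a
  -- realiser of the premise's body at x. That realiser needs G h again; it is rebuilt from the code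
  -- d = G-code, which G h passes to itself as a parameter (self-application instead of the recursion
  -- theorem). The meta-level (V2) for "g x realises φ(x)" then concludes.
  private
    GE : ∀ {n} → ETerm n → ETerm n → ETerm n
    GE d h = closureE d (pE d (pE h (lit 0)))
    -- context a′, u, n, a, x, d, h
    T-prog : Prog 7
    T-prog = appP (appP (expr (GE (var (# 5)) (var (# 6)))) (expr (lE (var (# 1))))) (expr (lit 0))
    -- context n, a, x, d, h
    B-prog : Prog 5
    B-prog = letP (appP (expr (var (# 2))) (expr (var (# 0))))
                  (pairP (expr (var (# 0))) (pairP (expr (lit 0)) (pairP (expr (lit 0)) (lamP T-prog))))
    -- context a, x, d, h
    g-prog : Prog 4
    g-prog = appP (appP (expr (var (# 3))) (expr (var (# 1)))) (lamP B-prog)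
    G-code : ℕ
    G-code = cP {3} (lamP g-prog)
    G : ℕ → ℕ
    G h = closure G-code (pair G-code (pair h 0))

  module _ (V2 : V2-meta V M T) {k : ℕ} (φ : Fm (suc k)) (ρ : Env k) (h : ℕ)
           (h-realises : h ⊩ hyp (V2f φ) [ ρ ]) where
    private
      ρ-g : ℕ → Env 3
      ρ-g x = x ∷ρ (G-code ∷ρ (h ∷ρ ρ₀))

    g : ℕ → ℕ
    g x = closure (cP g-prog) (encEnv (ρ-g x))

    G-· : ∀ x → G h · x ≃ g x
    G-· x = closure-cP-· (lamP g-prog) (G-code ∷ρ (h ∷ρ ρ₀)) refl

    g-Realises : ℕ → Set
    g-Realises x = ∀ a → ∃[ c ] (g x · a ≃ c × c ⊩ φ [ x ∷ρ ρ ])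

    private
      Body′ : Fm (suc k)
      Body′ = hyp (∀-body (hyp (V2f φ)))
      Conclusion′ : Fm (suc (suc (suc k)))
      Conclusion′ = concl (∧ʳ (∧ʳ (∃-body (∀-body Body′))))

    module _ (x : ℕ) (body : Body M T g-Realises x) (a : ℕ) where
      private
        ρ-b : Env 4
        ρ-b = a ∷ρ ρ-g x
        b : ℕ
        b = closure (cP B-prog) (encEnv ρ-b)
        t : ℕ → ℕ → ℕ
        t u n = closure (cP T-prog) (encEnv (u ∷ρ (n ∷ρ ρ-b)))

        B-prog-evP : ∀ n u → x · n ≃ u → evP B-prog (n ∷ρ ρ-b) (pair u (pair 0 (pair 0 (t u n))))
        B-prog-evP n u x·n≃u = u , (x , n , refl , refl , x·n≃u) ,
          (u , pair 0 (pair 0 (t u n)) , refl , (0 , pair 0 (t u n) , refl , (0 , t u n , refl , refl , refl) , refl) , refl)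

        t-realises : ∀ n u → (T (pR u) → g-Realises (pL u)) →
                     t u n ⊩ (Tf (rgt (var zero)) ⇒ Conclusion′) [ u ∷ρ (n ∷ρ (x ∷ρ ρ)) ]
        t-realises n u T⇒g a′ T-u = let c , g·0≃c , c-realises = T⇒g T-u 0 in c ,
          closure-cP-· T-prog (u ∷ρ (n ∷ρ ρ-b))
            (g (pL u) , 0 ,
             (G h , pL u , evE-closureE (var (# 5)) (pE (var (# 5)) (pE (var (# 6)) (lit 0))) (a′ ∷ρ (u ∷ρ (n ∷ρ ρ-b))) , refl ,
              G-· (pL u)) ,
             refl , g·0≃c) ,
          Equivalence.from (⊩-subF _ φ {u ∷ρ (n ∷ρ (x ∷ρ ρ))} {pL u ∷ρ ρ} (λ { zero → refl ; (suc i) → refl }) c) c-realises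

        b-realises : b ⊩ Body′ [ x ∷ρ ρ ]
        b-realises n = let u , x·n≃u , M-u , T⇒g = body n in
          pair u (pair 0 (pair 0 (t u n))) , closure-cP-· B-prog ρ-b (B-prog-evP n u x·n≃u) ,
          ∃-realises {A = ∃-body (∀-body Body′)} {ρ = n ∷ρ (x ∷ρ ρ)} {k = u} {a = pair 0 (pair 0 (t u n))}
            (∧-realises {A = app (var (# 2)) (var (# 1)) (var (# 0))} {B = Mf (rgt (var (# 0))) ∧f (Tf (rgt (var (# 0))) ⇒ Conclusion′)}
                        {ρ = u ∷ρ (n ∷ρ (x ∷ρ ρ))} {a = 0} {b = pair 0 (t u n)} x·n≃u
              (∧-realises {A = Mf (rgt (var (# 0)))} {B = Tf (rgt (var (# 0))) ⇒ Conclusion′} {ρ = u ∷ρ (n ∷ρ (x ∷ρ ρ))}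
                          {a = 0} {b = t u n} M-u (t-realises n u T⇒g)))

      g-step : ∃[ c ] (g x · a ≃ c × c ⊩ φ [ x ∷ρ ρ ])
      g-step =
        let hx , h·x≃hx , hx-realises = h-realises x
            c , hx·b≃c , c-realises = hx-realises b b-realises
        in c , closure-cP-· g-prog (ρ-g x) (hx , b , (h , x , refl , refl , h·x≃hx) , refl , hx·b≃c) , c-realises

  V2-realised : V2-meta V M T → ∀ k (φ : Fm (suc k)) → Realised (V2f φ)
  V2-realised V2 k φ = realised-by (V2f φ) (lamP (expr (GE (lit G-code) (var zero)))) λ ρ →
    closure (cP (expr (GE (lit G-code) (var zero)))) (encEnv ρ) , refl ,
    λ h h-realises → G h ,
      closure-cP-· (expr (GE (lit G-code) (var zero))) ρ (evE-closureE (lit G-code) (pE (lit G-code) (pE (var zero) (lit 0))) (h ∷ρ ρ)) ,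
      λ x → g V2 φ ρ h h-realises x , G-· V2 φ ρ h h-realises x ,
      λ a V-x → V2 (g-Realises V2 φ ρ h h-realises) (λ y body → g-step V2 φ ρ h h-realises y body) x V-x a

onLeftE onRightE : ∀ {n} → ETerm (suc n) → ETerm (suc n)
onLeftE e  = replace0E (lE (var zero)) e
onRightE e = replace0E (rE (var zero)) e

onBothE : ∀ {n} → ETerm (suc (suc n)) → ETerm (suc n)
onBothE e = split0E (lE (var zero)) (rE (var zero)) e

evE-onLeftE : ∀ {n} (e : ETerm (suc n)) a b (ρ : Env n) → evE (onLeftE e) (pair a b ∷ρ ρ) ≡ evE e (a ∷ρ ρ)
evE-onLeftE e a b ρ = trans (evE-replace0E _ e _ ρ) (cong (λ z → evE e (z ∷ρ ρ)) (pL-pair a b))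

evE-onRightE : ∀ {n} (e : ETerm (suc n)) a b (ρ : Env n) → evE (onRightE e) (pair a b ∷ρ ρ) ≡ evE e (b ∷ρ ρ)
evE-onRightE e a b ρ = trans (evE-replace0E _ e _ ρ) (cong (λ z → evE e (z ∷ρ ρ)) (pR-pair a b))

evE-onBothE : ∀ {n} (e : ETerm (suc (suc n))) a b (ρ : Env n) → evE (onBothE e) (pair a b ∷ρ ρ) ≡ evE e (b ∷ρ (a ∷ρ ρ))
evE-onBothE e a b ρ = trans (evE-split0E _ _ e _ ρ) (cong₂ (λ x y → evE e (y ∷ρ (x ∷ρ ρ))) (pL-pair a b) (pR-pair a b))

module AlmostNegative (V M T : ℕ → Set) where
  open Realisability V M T

  <-of-⊩ltF : ∀ {n} (t : Tm n) k (ρ : Env n) e → e ⊩ ltF (var zero) (wkT t) [ k ∷ρ ρ ] → k < ⟦ t ⟧ ρ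
  <-of-⊩ltF t k ρ e h =
    subst (k <_) (trans h (⟦wkT-wkT⟧ t (pL e) k ρ)) (subst (_≤ k + suc (pL e)) (+-comm k 1) (+-monoʳ-≤ k (s≤s z≤n)))

  ⊩ltF-of-< : ∀ {n} (t : Tm n) k (ρ : Env n) → k < ⟦ t ⟧ ρ → pair (⟦ t ⟧ ρ ∸ suc k) 0 ⊩ ltF (var zero) (wkT t) [ k ∷ρ ρ ]
  ⊩ltF-of-< t k ρ lt = ∃-realises {A = (wkT (var zero) +T sucT (var zero)) ≐ wkT (wkT t)} {ρ = k ∷ρ ρ}
    (trans (trans (+-suc k _) (m+[n∸m]≡n lt)) (sym (⟦wkT-wkT⟧ t (⟦ t ⟧ ρ ∸ suc k) k ρ)))

  decideΔ₀ realiseΔ₀ : ∀ {n} {A : Fm n} → IsΔ0 A → ETerm n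
  decideΔ₀ (d-eq t s)   = eqE (termE t) (termE s)
  decideΔ₀ d-bot        = lit 1
  decideΔ₀ (d-and p q)  = andE (decideΔ₀ p) (decideΔ₀ q)
  decideΔ₀ (d-or p q)   = mulE (decideΔ₀ p) (decideΔ₀ q)
  decideΔ₀ (d-imp p q)  = mulE (subtE (lit 1) (decideΔ₀ p)) (decideΔ₀ q)
  decideΔ₀ (d-ball t p) = allE (termE t) (decideΔ₀ p)
  decideΔ₀ (d-bex t p)  = exE (termE t) (decideΔ₀ p)
  realiseΔ₀ (d-eq t s)   = lit 0
  realiseΔ₀ d-bot        = lit 0
  realiseΔ₀ (d-and p q)  = pE (realiseΔ₀ p) (realiseΔ₀ q)
  realiseΔ₀ (d-or p q)   = pE (decideΔ₀ p) (selE (decideΔ₀ p) (realiseΔ₀ p) (realiseΔ₀ q))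
  realiseΔ₀ (d-imp p q)  = closeE (cComp (cE (realiseΔ₀ q)) cRight)
  realiseΔ₀ {n} (d-ball t p) = closeE (cE (closeE {suc n} (cComp (cE (realiseΔ₀ p)) cRight)))
  realiseΔ₀ (d-bex t p)  = pE k (pE (pE (subtE (termE t) (sE k)) (lit 0)) (substE k (realiseΔ₀ p)))
    where
    k = muE (termE t) (decideΔ₀ p)

  decideΔ₀-sound : ∀ {n} {A : Fm n} (p : IsΔ0 A) (ρ : Env n) → evE (decideΔ₀ p) ρ ≡ 0 → evE (realiseΔ₀ p) ρ ⊩ A [ ρ ]
  decideΔ₀-complete : ∀ {n} {A : Fm n} (p : IsΔ0 A) (ρ : Env n) e → e ⊩ A [ ρ ] → evE (decideΔ₀ p) ρ ≡ 0

  decideΔ₀-sound (d-eq t s) ρ h = trans (sym (evE-termE t ρ)) (trans (eqN≡0⇒≡ _ _ h) (evE-termE s ρ))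
  decideΔ₀-sound d-bot ρ ()
  decideΔ₀-sound (d-and {A} {B} p q) ρ h =
    ∧-realises {A = A} {B = B} {ρ = ρ} {a = evE (realiseΔ₀ p) ρ} {b = evE (realiseΔ₀ q) ρ}
      (decideΔ₀-sound p ρ (andN-proj₁ h)) (decideΔ₀-sound q ρ (andN-proj₂ h))
  decideΔ₀-sound (d-or {A} {B} p q) ρ h =
    ∨-realises {A = A} {B = B} {ρ = ρ} (evE (decideΔ₀ p) ρ) (evE (realiseΔ₀ p) ρ) (evE (realiseΔ₀ q) ρ) (decideΔ₀-sound p ρ) right
    where
    right : evE (decideΔ₀ p) ρ ≢ 0 → evE (realiseΔ₀ q) ρ ⊩ B [ ρ ]
    right ne with m*n≡0⇒m≡0∨n≡0 (evE (decideΔ₀ p) ρ) h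
    ... | inj₁ z = ⊥-elim (ne z)
    ... | inj₂ z = decideΔ₀-sound q ρ z
  decideΔ₀-sound (d-imp p q) ρ h a ha =
    evE (realiseΔ₀ q) ρ , closeE-· _ ρ (cComp-· (≃-respʳ (pR-pair a _) cRight-·) (cE-· (realiseΔ₀ q) ρ)) , decideΔ₀-sound q ρ q-holds
    where
    q-holds : evE (decideΔ₀ q) ρ ≡ 0
    q-holds with m*n≡0⇒m≡0∨n≡0 (1 ∸ evE (decideΔ₀ p) ρ) h
    ... | inj₂ z = z
    ... | inj₁ z with trans (sym (cong (1 ∸_) (decideΔ₀-complete p ρ a ha))) z
    ...   | ()
  decideΔ₀-sound (d-ball t p) ρ h k = evE (closeE c) (k ∷ρ ρ) , closeE-· (cE (closeE c)) ρ (cE-· (closeE c) (k ∷ρ ρ)) ,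
    λ a ha → evE (realiseΔ₀ p) (k ∷ρ ρ) ,
      closeE-· c (k ∷ρ ρ) (cComp-· (≃-respʳ (pR-pair a _) cRight-·) (cE-· (realiseΔ₀ p) (k ∷ρ ρ))) ,
      decideΔ₀-sound p (k ∷ρ ρ) (allN-elim _ _ h k (subst (k <_) (sym (evE-termE t ρ)) (<-of-⊩ltF t k ρ a ha)))
    where
    c = cComp (cE (realiseΔ₀ p)) cRight
  decideΔ₀-sound (d-bex t {A} p) ρ h = ∃-realises {A = ltF (var zero) (wkT t) ∧f A} {ρ = ρ} {k = k} {a = pair (pair (bound ∸ suc k) 0) g}
    (∧-realises {A = ltF (var zero) (wkT t)} {B = A} {ρ = k ∷ρ ρ} {a = pair (bound ∸ suc k) 0} {b = g}
      (subst (λ z → pair (z ∸ suc k) 0 ⊩ ltF (var zero) (wkT t) [ k ∷ρ ρ ]) (sym (evE-termE t ρ))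
        (⊩ltF-of-< t k ρ (subst (k <_) (evE-termE t ρ) (proj₁ found))))
      (subst (λ z → z ⊩ A [ k ∷ρ ρ ]) (sym (evE-substE (muE (termE t) (decideΔ₀ p)) (realiseΔ₀ p) ρ))
        (decideΔ₀-sound p (k ∷ρ ρ) (proj₂ found))))
    where
    bound = evE (termE t) ρ
    f = λ i → evE (decideΔ₀ p) (i ∷ρ ρ)
    k = muN bound f
    g = evE (substE (muE (termE t) (decideΔ₀ p)) (realiseΔ₀ p)) ρ
    found = let i , i<b , fi = exN-elim bound f h in muN-found bound f i i<b fi

  decideΔ₀-complete (d-eq t s) ρ e h = ≡⇒eqN≡0 (trans (evE-termE t ρ) (trans h (sym (evE-termE s ρ))))
  decideΔ₀-complete d-bot ρ e ()
  decideΔ₀-complete (d-and p q) ρ e (ha , hb) = andN-intro (decideΔ₀-complete p ρ _ ha) (decideΔ₀-complete q ρ _ hb)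
  decideΔ₀-complete (d-or p q) ρ e (inj₁ (_ , ha)) = m≡0⇒m*n≡0 (evE (decideΔ₀ q) ρ) (decideΔ₀-complete p ρ _ ha)
  decideΔ₀-complete (d-or p q) ρ e (inj₂ (_ , hb)) = n≡0⇒m*n≡0 (evE (decideΔ₀ p) ρ) (decideΔ₀-complete q ρ _ hb)
  decideΔ₀-complete (d-imp p q) ρ e h = 1∸m*n≡0 (evE (decideΔ₀ p) ρ) (evE (decideΔ₀ q) ρ)
    λ z → let b , _ , hb = h _ (decideΔ₀-sound p ρ z) in decideΔ₀-complete q ρ b hb
  decideΔ₀-complete (d-ball t p) ρ e h = allN-intro (evE (termE t) ρ) _ λ i lt →
    let b , _ , hb = h i
        c , _ , hc = hb (pair (⟦ t ⟧ ρ ∸ suc i) 0) (⊩ltF-of-< t i ρ (subst (i <_) (evE-termE t ρ) lt))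
    in decideΔ₀-complete p (i ∷ρ ρ) c hc
  decideΔ₀-complete (d-bex t p) ρ e (hl , ha) = exN-intro (evE (termE t) ρ) _ (pL e)
    (subst (pL e <_) (sym (evE-termE t ρ)) (<-of-⊩ltF t (pL e) ρ (pL (pR e)) hl)) (decideΔ₀-complete p (pL e ∷ρ ρ) _ ha)

  -- checkΣ₁ p is 0 on w exactly when w codes a witness for A: for an app atom, a certificate of it.
  checkΣ₁ realiseΣ₁ : ∀ {n} {A : Fm n} → IsΣ1 A → ETerm (suc n)
  checkΣ₁ (s-d0 p)      = wkE (decideΔ₀ p)
  checkΣ₁ (s-app t s u) = andE (sbE (var zero ∷ []) validE) (andE (subtE (lit 1) (lE (var zero)))
    (eqE (lE (rE (var zero))) (pE (wkE (termE t)) (pE (wkE (termE s)) (wkE (termE u))))))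
  checkΣ₁ (s-and p q)   = andE (onLeftE (checkΣ₁ p)) (onRightE (checkΣ₁ q))
  checkΣ₁ (s-or p q)    = selE (lE (var zero)) (onRightE (checkΣ₁ p)) (onRightE (checkΣ₁ q))
  checkΣ₁ (s-ex p)      = onBothE (checkΣ₁ p)
  realiseΣ₁ (s-d0 p)      = wkE (realiseΔ₀ p)
  realiseΣ₁ (s-app t s u) = lit 0
  realiseΣ₁ (s-and p q)   = pE (onLeftE (realiseΣ₁ p)) (onRightE (realiseΣ₁ q))
  realiseΣ₁ (s-or p q)    = pE (lE (var zero)) (selE (lE (var zero)) (onRightE (realiseΣ₁ p)) (onRightE (realiseΣ₁ q)))
  realiseΣ₁ (s-ex p)      = pE (lE (var zero)) (onBothE (realiseΣ₁ p))

  checkΣ₁-sound : ∀ {n} {A : Fm n} (p : IsΣ1 A) (ρ : Env n) w → evE (checkΣ₁ p) (w ∷ρ ρ) ≡ 0 →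
                  evE (realiseΣ₁ p) (w ∷ρ ρ) ⊩ A [ ρ ]
  checkΣ₁-sound {A = A} (s-d0 p) ρ w h = subst (λ c → c ⊩ A [ ρ ]) (sym (evE-wkE (realiseΔ₀ p) w ρ))
    (decideΔ₀-sound p ρ (trans (sym (evE-wkE (decideΔ₀ p) w ρ)) h))
  checkΣ₁-sound (s-app t s u) ρ w h =
    certificate-sound w (trans (sym (evE-validE (evEV (var zero ∷ []) (w ∷ρ ρ)))) (andN-proj₁ h) , andN-proj₁ (andN-proj₂ h) , first)
    where
    term : ∀ (x : Tm _) → evE (wkE (termE x)) (w ∷ρ ρ) ≡ ⟦ x ⟧ ρ
    term x = trans (evE-wkE (termE x) w ρ) (evE-termE x ρ)
    first : pL (pR w) ≡ judgement (⟦ t ⟧ ρ) (⟦ s ⟧ ρ) (⟦ u ⟧ ρ)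
    first = trans (eqN≡0⇒≡ _ _ (andN-proj₂ (andN-proj₂ h)))
              (trans (cong₂ pair (term t) (cong₂ pair (term s) (term u))) (sym (judgement-def _ _ _)))
  checkΣ₁-sound (s-and {A} {B} p q) ρ w h = ∧-realises {A = A} {B = B} {ρ = ρ}
    (subst (λ c → c ⊩ A [ ρ ]) (sym (evE-replace0E _ (realiseΣ₁ p) w ρ))
      (checkΣ₁-sound p ρ (pL w) (trans (sym (evE-replace0E _ (checkΣ₁ p) w ρ)) (andN-proj₁ h))))
    (subst (λ c → c ⊩ B [ ρ ]) (sym (evE-replace0E _ (realiseΣ₁ q) w ρ))
      (checkΣ₁-sound q ρ (pR w) (trans (sym (evE-replace0E _ (checkΣ₁ q) w ρ)) (andN-proj₂ h))))
  checkΣ₁-sound (s-or {A} {B} p q) ρ w h =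
    ∨-realises {A = A} {B = B} {ρ = ρ} (pL w) (evE (onRightE (realiseΣ₁ p)) (w ∷ρ ρ)) (evE (onRightE (realiseΣ₁ q)) (w ∷ρ ρ)) left right
    where
    cases = selN≡0 (pL w) (evE (onRightE (checkΣ₁ p)) (w ∷ρ ρ)) (evE (onRightE (checkΣ₁ q)) (w ∷ρ ρ)) h
    left : pL w ≡ 0 → evE (onRightE (realiseΣ₁ p)) (w ∷ρ ρ) ⊩ A [ ρ ]
    left z with cases
    ... | inj₁ (_ , x) = subst (λ c → c ⊩ A [ ρ ]) (sym (evE-replace0E _ (realiseΣ₁ p) w ρ))
                           (checkΣ₁-sound p ρ (pR w) (trans (sym (evE-replace0E _ (checkΣ₁ p) w ρ)) x))
    ... | inj₂ (nz , _) = ⊥-elim (nz z)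
    right : pL w ≢ 0 → evE (onRightE (realiseΣ₁ q)) (w ∷ρ ρ) ⊩ B [ ρ ]
    right nz with cases
    ... | inj₁ (z , _) = ⊥-elim (nz z)
    ... | inj₂ (_ , x) = subst (λ c → c ⊩ B [ ρ ]) (sym (evE-replace0E _ (realiseΣ₁ q) w ρ))
                           (checkΣ₁-sound q ρ (pR w) (trans (sym (evE-replace0E _ (checkΣ₁ q) w ρ)) x))
  checkΣ₁-sound (s-ex {A} p) ρ w h = ∃-realises {A = A} {ρ = ρ} {k = pL w} {a = evE (onBothE (realiseΣ₁ p)) (w ∷ρ ρ)}
    (subst (λ c → c ⊩ A [ pL w ∷ρ ρ ]) (sym (evE-split0E _ _ (realiseΣ₁ p) w ρ))
      (checkΣ₁-sound p (pL w ∷ρ ρ) (pR w) (trans (sym (evE-split0E _ _ (checkΣ₁ p) w ρ)) h)))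

  checkΣ₁-complete : ∀ {n} {A : Fm n} (p : IsΣ1 A) (ρ : Env n) e → e ⊩ A [ ρ ] → ∃[ w ] (evE (checkΣ₁ p) (w ∷ρ ρ) ≡ 0)
  checkΣ₁-complete (s-d0 p) ρ e h = 0 , trans (evE-wkE (decideΔ₀ p) 0 ρ) (decideΔ₀-complete p ρ e h)
  checkΣ₁-complete (s-app t s u) ρ e h with certificate h
  ... | w , valid , nonempty , first =
    w , andN-intro (trans (evE-validE (evEV (var zero ∷ []) (w ∷ρ ρ))) valid) (andN-intro nonempty
      (≡⇒eqN≡0 (trans first (trans (judgement-def _ _ _) (sym (cong₂ pair (term t) (cong₂ pair (term s) (term u))))))))
    where
    term : ∀ (x : Tm _) → evE (wkE (termE x)) (w ∷ρ ρ) ≡ ⟦ x ⟧ ρ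
    term x = trans (evE-wkE (termE x) w ρ) (evE-termE x ρ)
  checkΣ₁-complete (s-and p q) ρ e (ha , hb) with checkΣ₁-complete p ρ _ ha | checkΣ₁-complete q ρ _ hb
  ... | w₁ , h₁ | w₂ , h₂ = pair w₁ w₂ ,
    andN-intro (trans (evE-onLeftE (checkΣ₁ p) w₁ w₂ ρ) h₁) (trans (evE-onRightE (checkΣ₁ q) w₁ w₂ ρ) h₂)
  checkΣ₁-complete (s-or p q) ρ e (inj₁ (_ , ha)) with checkΣ₁-complete p ρ _ ha
  ... | w , h = pair 0 w ,
    trans (cong (λ d → selN d (evE (onRightE (checkΣ₁ p)) (pair 0 w ∷ρ ρ)) (evE (onRightE (checkΣ₁ q)) (pair 0 w ∷ρ ρ))) (pL-pair 0 w))
          (trans (evE-onRightE (checkΣ₁ p) 0 w ρ) h)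
  checkΣ₁-complete (s-or p q) ρ e (inj₂ (_ , hb)) with checkΣ₁-complete q ρ _ hb
  ... | w , h = pair 1 w ,
    trans (cong (λ d → selN d (evE (onRightE (checkΣ₁ p)) (pair 1 w ∷ρ ρ)) (evE (onRightE (checkΣ₁ q)) (pair 1 w ∷ρ ρ))) (pL-pair 1 w))
          (trans (evE-onRightE (checkΣ₁ q) 1 w ρ) h)
  checkΣ₁-complete (s-ex p) ρ e h with checkΣ₁-complete p (pL e ∷ρ ρ) (pR e) h
  ... | w , h′ = pair (pL e) w , trans (evE-onBothE (checkΣ₁ p) (pL e) w ρ) h′

  searchΣ₁ : ∀ {n} {A : Fm n} → IsΣ1 A → Prog n
  searchΣ₁ p = letP (muP (expr (checkΣ₁ p))) (expr (realiseΣ₁ p))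

  searchΣ₁-realises : ∀ {n} {A : Fm n} (p : IsΣ1 A) (ρ : Env n) e → e ⊩ A [ ρ ] →
                      ∃[ v ] (evP (searchΣ₁ p) ρ v × v ⊩ A [ ρ ])
  searchΣ₁-realises p ρ e h with checkΣ₁-complete p ρ e h
  ... | w , hw with least-zero (λ w → evE (checkΣ₁ p) (w ∷ρ ρ)) w hw
  ...   | y , hy , below = evE (realiseΣ₁ p) (y ∷ρ ρ) , (y , (hy , below) , refl) , checkΣ₁-sound p ρ y hy

  -- A realiser of an almost-negative formula can be computed from its free variables alone: Σ₁ parts
  -- by unbounded search, atoms V, M, T by anything, and ⇒, ∀ from the realiser of their conclusion.
  canonical : ∀ {n} {A : Fm n} → IsAN A → Prog n
  canonical (an-s1 s)     = searchΣ₁ s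
  canonical (an-V t)      = expr (lit 0)
  canonical (an-M t)      = expr (lit 0)
  canonical (an-T t)      = expr (lit 0)
  canonical (an-and p q)  = pairP (canonical p) (canonical q)
  canonical (an-imp p q)  = expr (closeE (cComp (cP (canonical q)) cRight))
  canonical (an-all p)    = expr (closeE (cP (canonical p)))

  canonical-realises : ∀ {n} {A : Fm n} (p : IsAN A) (ρ : Env n) e → e ⊩ A [ ρ ] →
                       ∃[ v ] (evP (canonical p) ρ v × v ⊩ A [ ρ ])
  canonical-realises (an-s1 s) ρ e h = searchΣ₁-realises s ρ e h
  canonical-realises (an-V t)  ρ e h = 0 , refl , h
  canonical-realises (an-M t)  ρ e h = 0 , refl , h
  canonical-realises (an-T t)  ρ e h = 0 , refl , h
  canonical-realises (an-and {A} {B} p q) ρ e (ha , hb) with canonical-realises p ρ _ ha | canonical-realises q ρ _ hb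
  ... | a , eva , ra | b , evb , rb = pair a b , (a , b , eva , evb , refl) , ∧-realises {A = A} {B = B} {ρ = ρ} ra rb
  canonical-realises (an-imp p q) ρ e h =
    closure c (encEnv ρ) , evE-closeE c ρ , λ a ha →
      let b , _ , hb = h a ha
          v , ev , rv = canonical-realises q ρ b hb
      in v , constClosure-· a (cP-· (canonical q) ρ ev) , rv
    where
    c = cComp (cP (canonical q)) cRight
  canonical-realises (an-all p) ρ e h =
    closure (cP (canonical p)) (encEnv ρ) , evE-closeE (cP (canonical p)) ρ , λ k →
      let b , _ , hb = h k
          v , ev , rv = canonical-realises p (k ∷ρ ρ) b hb
      in v , closure-cP-· (canonical p) ρ ev , rv

module ChurchsThesis (V M T : ℕ → Set) where
  open Realisability V M T
  open AlmostNegative V M T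

  -- If a realises ∀n (φ(n) → ∃m ψ(n, m)) and c_n is the canonical realiser of φ(n), then w_n = a · n · c_n
  -- gives the index E = λn. (w_n)_L and realisers (w_n)_R of ψ(n, E n). A realiser r of φ(n) only serves
  -- to show that c_n realises φ(n), so E does not depend on it.
  module _ {k : ℕ} (φ : Fm (suc k)) (ψ : Fm (suc (suc k))) (an : IsAN φ) where
    private
      -- context n, a, ρ: the coded environment n ∷ ρ
      φ-envE : ETerm (suc (suc k))
      φ-envE = pE (var (# 0)) (rE (rE envE))
      -- context n, a, ρ
      w-prog : Prog (suc (suc k))
      w-prog = appP (appP (expr (var (# 1))) (expr (var (# 0)))) (appP (expr (lit (cP (canonical an)))) (expr φ-envE))
      -- context r, n, a, ρ
      w-prog′ : Prog (suc (suc (suc k)))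
      w-prog′ = appP (appP (expr (var (# 2))) (expr (var (# 1)))) (appP (expr (lit (cP (canonical an)))) (expr (wkE φ-envE)))
      E-prog : Prog (suc (suc k))
      E-prog = letP w-prog (expr (lE (var (# 0))))
      S-prog′ : Prog (suc (suc (suc k)))
      S-prog′ = letP w-prog′ (pairP (expr (lE (var (# 0)))) (pairP (expr (lit 0)) (expr (rE (var (# 0))))))
      S-prog : Prog (suc (suc k))
      S-prog = expr (closeE (cP S-prog′))

    ECT-prog : Prog (suc k)
    ECT-prog = pairP (expr (closeE (cP E-prog))) (expr (closeE (cP S-prog)))

    module _ (ρ : Env k) (a : ℕ) (a-realises : a ⊩ hyp (ECTf φ ψ) [ ρ ]) where
      private
        ρₐ : Env (suc k)
        ρₐ = a ∷ρ ρ
        Concl : Fm (suc k)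
        Concl = ∃-body (concl (ECTf φ ψ))

        evE-φ-envE : ∀ n → evE φ-envE (n ∷ρ ρₐ) ≡ encEnv (n ∷ρ ρ)
        evE-φ-envE n = cong (pair n) (trans (cong (λ z → pR (pR z)) (evE-envE (n ∷ρ ρₐ)))
          (trans (cong pR (pR-pair n (encEnv ρₐ))) (pR-pair a (encEnv ρ))))

      E S : ℕ
      E = closure (cP E-prog) (encEnv ρₐ)
      S = closure (cP S-prog) (encEnv ρₐ)

      module _ (n : ℕ) where
        private
          φ-realiser = canonical-realises an (n ∷ρ ρ)

        module _ (r : ℕ) (r-realises : r ⊩ φ [ n ∷ρ ρ ]) where
          private
            c = proj₁ (φ-realiser r r-realises)
            c-evP = proj₁ (proj₂ (φ-realiser r r-realises))
            c-realises = proj₂ (proj₂ (φ-realiser r r-realises))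
            a·n = proj₁ (a-realises n)
            a·n≃ = proj₁ (proj₂ (a-realises n))
            w-result = proj₂ (proj₂ (a-realises n)) c c-realises
            a·n·c≃w = proj₁ (proj₂ w-result)
            w-realises = proj₂ (proj₂ w-result)
            canonical-· : cP (canonical an) · encEnv (n ∷ρ ρ) ≃ c
            canonical-· = cP-· (canonical an) (n ∷ρ ρ) c-evP

          w : ℕ
          w = proj₁ w-result

          w-prog-evP : evP w-prog (n ∷ρ ρₐ) w
          w-prog-evP = a·n , c , (a , n , refl , refl , a·n≃) , (_ , _ , refl , evE-φ-envE n , canonical-·) , a·n·c≃w

          w-prog′-evP : ∀ r′ → evP w-prog′ (r′ ∷ρ (n ∷ρ ρₐ)) w
          w-prog′-evP r′ = a·n , c , (a , n , refl , refl , a·n≃) ,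
            (_ , _ , refl , trans (evE-wkE φ-envE r′ (n ∷ρ ρₐ)) (evE-φ-envE n) , canonical-·) , a·n·c≃w

          E-· : E · n ≃ pL w
          E-· = closure-· (cP-· E-prog (n ∷ρ ρₐ) (w , w-prog-evP , refl))

          S-result : ℕ
          S-result = pair (pL w) (pair 0 (pR w))

          S-result-realises : S-result ⊩ concl (∀-body Concl) [ n ∷ρ (E ∷ρ ρ) ]
          S-result-realises = ∃-realises {A = ∃-body (concl (∀-body Concl))} {ρ = n ∷ρ (E ∷ρ ρ)} {k = pL w} {a = pair 0 (pR w)}
            (∧-realises {A = ∧ˡ (∃-body (concl (∀-body Concl)))} {B = ∧ʳ (∃-body (concl (∀-body Concl)))}
                        {ρ = pL w ∷ρ (n ∷ρ (E ∷ρ ρ))} {a = 0} {b = pR w} E-·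
              (Equivalence.from (⊩-renF _ ψ {pL w ∷ρ (n ∷ρ (E ∷ρ ρ))} {pL w ∷ρ (n ∷ρ ρ)}
                (λ { zero → refl ; (suc zero) → refl ; (suc (suc i)) → refl }) (pR w)) w-realises))

        S-at : ℕ
        S-at = closure (cP S-prog′) (encEnv (n ∷ρ ρₐ))

        S-· : S · n ≃ S-at
        S-· = closure-· (cP-· S-prog (n ∷ρ ρₐ) (evE-closeE (cP S-prog′) (n ∷ρ ρₐ)))

        S-at-· : ∀ r (r-realises : r ⊩ φ [ n ∷ρ ρ ]) → S-at · r ≃ S-result r r-realises
        S-at-· r r-realises = closure-· (cP-· S-prog′ (r ∷ρ (n ∷ρ ρₐ))
          (w r r-realises , w-prog′-evP r r-realises r , (_ , _ , refl , (0 , _ , refl , refl , refl) , refl)))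

      S-realises : S ⊩ Concl [ E ∷ρ ρ ]
      S-realises n = S-at n , S-· n , λ r r-realises′ →
        let r-realises = Equivalence.to (⊩-renF _ φ {n ∷ρ (E ∷ρ ρ)} {n ∷ρ ρ} (λ { zero → refl ; (suc i) → refl }) r) r-realises′
        in S-result n r r-realises , S-at-· n r r-realises , S-result-realises n r r-realises

  ECT-realised : ∀ k (φ : Fm (suc k)) (ψ : Fm (suc (suc k))) → IsAN φ → Realised (ECTf φ ψ)
  ECT-realised k φ ψ an = realised-by (ECTf φ ψ) (lamP (ECT-prog φ ψ an)) λ ρ →
    closure (cP (ECT-prog φ ψ an)) (encEnv ρ) , refl , λ a a-realises →
      let E′ = E φ ψ an ρ a a-realises ; S′ = S φ ψ an ρ a a-realises in
      pair E′ S′ , closure-cP-· (ECT-prog φ ψ an) ρ (E′ , S′ , evE-closeE _ (a ∷ρ ρ) , evE-closeE _ (a ∷ρ ρ) , refl) ,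
      ∃-realises {A = ∃-body (concl (ECTf φ ψ))} {ρ = ρ} {k = E′} {a = S′} (S-realises φ ψ an ρ a a-realises)

mainTheorem7 : (V M T : ℕ → Set) →
    V1-meta V M T → V2-meta V M T → X1-meta M T → X2-meta M T →
    Realise.Realised V M T V1f
    × (∀ k (φ : Fm (suc k)) → Realise.Realised V M T (V2f φ))
    × Realise.Realised V M T X1f
    × Realise.Realised V M T X2f
    × (∀ k (φ : Fm (suc k)) (ψ : Fm (suc (suc k))) → IsAN φ →
    Realise.Realised V M T (ECTf φ ψ))
mainTheorem7 V M T V1 V2 X1 X2 = V1-realised V1 , V2-realised V2 , X1-realised X1 , X2-realised X2 , ECT-realised
  where
  open AxiomRealisers V M T
  open ChurchsThesis V M T
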